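{- Let $P=\{p_1,\dots,p_n\}\subset\mathbb{R}^2$ ($n\ge3$) be in general position. For any $f\in\mathbb{R}^{\binom n2}$, the set $X_f(P)$ is bounded.
   Context: General position: no three collinear. Motions $v\in(\mathbb{R}^2)^n$, normalized by $v_q=0$ and first coordinate of $v_{q'}=0$ for two fixed points $q,q'$ with distinct second coordinates. $X_f(P)$ is the set of normalized $v$ with $\langle p_i-p_j,v_i-v_j\rangle\ge f_{ij}$ for all pairs $i<j$ that are not edges of the convex hull of $P$, and $\langle p_i-p_j,v_i-v_j\rangle=f_{ij}$ for all pairs $ij$ that are convex hull edges. -}

module Defs where

open import Data.Nat using (ℕ)
open import Data.Fin using (Fin; toℕ)
open import Data.Product using (Σ; ∃; _×_; _,_; proj₁; proj₂)
open import Data.Sum using (_⊎_)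
open import Relation.Binary.PropositionalEquality using (_≡_; _≢_)
open import Relation.Nullary using (¬_)
open import Level using (0ℓ)

-- The real numbers, axiomatised as a complete ordered field
-- (Dedekind/sup-complete ordered field; unique up to isomorphism).

record Reals : Set₁ where
  infixl 6 _+_ _-_
  infixl 7 _*_
  infix 4 _≤_ _<_
  field
    ℝ    : Set
    0# 1# : ℝ
    _+_ _*_ : ℝ → ℝ → ℝ
    -_   : ℝ → ℝ
    _≤_  : ℝ → ℝ → Set
    +-assoc : ∀ x y z → (x + y) + z ≡ x + (y + z)
    +-comm  : ∀ x y → x + y ≡ y + x
    +-identityˡ : ∀ x → 0# + x ≡ x
    -‿inverseˡ : ∀ x → (- x) + x ≡ 0#
    *-assoc : ∀ x y z → (x * y) * z ≡ x * (y * z)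
    *-comm  : ∀ x y → x * y ≡ y * x
    *-identityˡ : ∀ x → 1# * x ≡ x
    distribˡ : ∀ x y z → x * (y + z) ≡ (x * y) + (x * z)
    0≢1 : 0# ≢ 1#
    inverse : ∀ x → x ≢ 0# → ∃ λ y → x * y ≡ 1#
    ≤-refl  : ∀ x → x ≤ x
    ≤-trans : ∀ {x y z} → x ≤ y → y ≤ z → x ≤ z
    ≤-antisym : ∀ {x y} → x ≤ y → y ≤ x → x ≡ y
    ≤-total : ∀ x y → x ≤ y ⊎ y ≤ x
    +-mono-≤ : ∀ {x y} z → x ≤ y → x + z ≤ y + z
    *-nonneg : ∀ {x y} → 0# ≤ x → 0# ≤ y → 0# ≤ x * y
    sup : (S : ℝ → Set) → (∃ λ x → S x) → (∃ λ b → ∀ x → S x → x ≤ b) →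
          ∃ λ s → (∀ x → S x → x ≤ s) × (∀ b → (∀ x → S x → x ≤ b) → s ≤ b)

  _-_ : ℝ → ℝ → ℝ
  x - y = x + (- y)

  _<_ : ℝ → ℝ → Set
  x < y = (x ≤ y) × (x ≢ y)

module Geometry (R : Reals) where
  open Reals R

  ℝ² : Set
  ℝ² = ℝ × ℝ

  _-²_ : ℝ² → ℝ² → ℝ²
  (a , b) -² (c , d) = (a - c , b - d)

  ⟨_,_⟩ : ℝ² → ℝ² → ℝ
  ⟨ (a , b) , (c , d) ⟩ = (a * c) + (b * d)

  det : ℝ² → ℝ² → ℝ
  det (a , b) (c , d) = (a * d) - (b * c)

  orient : ℝ² → ℝ² → ℝ² → ℝ
  orient x y z = det (y -² x) (z -² x)

  GeneralPosition : ∀ {n} → (Fin n → ℝ²) → Set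
  GeneralPosition {n} p =
    ∀ (i j k : Fin n) → i ≢ j → j ≢ k → i ≢ k → orient (p i) (p j) (p k) ≢ 0#

  -- ij is an edge of the convex hull of P: i ≢ j and the line through
  -- p i, p j supports P, i.e. all points of P lie in one closed half-plane.
  HullEdge : ∀ {n} → (Fin n → ℝ²) → Fin n → Fin n → Set
  HullEdge {n} p i j =
    i ≢ j × ((∀ k → 0# ≤ orient (p i) (p j) (p k)) ⊎
             (∀ k → orient (p i) (p j) (p k) ≤ 0#))

  -- X_f(P), with normalisation v_a = 0 and first coordinate of v_b = 0
  -- (a, b are the indices of the fixed points q, q').  f_ij is only
  -- consulted for toℕ i < toℕ j.
  InX : ∀ {n} → (Fin n → ℝ²) → (a b : Fin n) → (Fin n → Fin n → ℝ) →
        (Fin n → ℝ²) → Set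
  InX {n} p a b f v =
    v a ≡ (0# , 0#) × proj₁ (v b) ≡ 0# ×
    (∀ (i j : Fin n) → toℕ i Data.Nat.< toℕ j →
       (HullEdge p i j → ⟨ p i -² p j , v i -² v j ⟩ ≡ f i j) ×
       (¬ HullEdge p i j → f i j ≤ ⟨ p i -² p j , v i -² v j ⟩))

  Bounded : ∀ {n} → ((Fin n → ℝ²) → Set) → Set
  Bounded {n} X = ∃ λ M → ∀ v → X v → ∀ i →
    (- M ≤ proj₁ (v i)) × (proj₁ (v i) ≤ M) × (- M ≤ proj₂ (v i)) × (proj₂ (v i) ≤ M)

{-# OPTIONS --safe #-}

-- Write e i j v = ⟨ p i - p j , v i - v j ⟩ for the strain of the pair ij under the motion v. On X_f
-- every strain is bounded below by f, and the strains of hull edges are constant. Upper bounds come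
-- from linear relations between strains. For consecutive hull vertices i, j, l the strain of the
-- diagonal il is a bounded combination of the two side strains plus orient i j l times the drop in
-- angular velocity from side ij to side jl; these drops are bounded below and sum to zero around the
-- hull, so they are bounded. Four points in general position carry an equilibrium stress, so five
-- bounded strains among them bound the sixth: this reaches all pairs of hull vertices, and then every
-- point, since an interior point lies in a triangle of hull vertices, where the signs of the stress
-- turn the lower bounds on its spokes into upper bounds. Finally, with v a = 0 and proj₁ (v b) = 0,
-- the strains from a and b determine every velocity by Cramer's rule.

module Submission where

open import Level using (0ℓ)
open import Algebra.Bundles using (CommutativeRing)
open import Algebra.Structures using (IsCommutativeRing)
import Algebra.Solver.Ring.AlmostCommutativeRing as ACR
open import Data.Empty using (⊥; ⊥-elim)
open import Data.Fin as Fin using (Fin; toℕ; punchIn; punchOut)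
import Data.Fin.Properties as Fin
open import Data.Integer as ℤ using (ℤ; -[1+_]; _⊖_)
import Data.Integer.Properties as ℤ
open import Data.List using (List; []; _∷_; allFin)
open import Data.List.Membership.Propositional using (_∈_)
open import Data.List.Membership.Propositional.Properties using (∈-allFin)
open import Data.List.Relation.Unary.Any using (here; there)
open import Data.Maybe using (Maybe; just; nothing)
open import Data.Nat as ℕ using (ℕ; zero; suc; s≤s)
import Data.Nat.Properties as ℕ
open import Data.Product using (∃; ∃₂; ∃-syntax; _×_; _,_; proj₁; proj₂)
import Data.Sign as Sign
open import Data.Sum using (_⊎_; inj₁; inj₂)
open import Data.Unit using (tt)
open import Relation.Binary.Definitions using (DecidableEquality; tri<; tri≈; tri>)
open import Relation.Binary.PropositionalEquality
open import Relation.Nullary using (Dec; yes; no; ¬_; ¬?; _×-dec_)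
open import Relation.Unary using (Decidable; U)
open import Relation.Unary.Properties using (U?)

open import Defs

module RealsProperties (R : Reals) where
  open Reals R

  +-identityʳ : ∀ x → x + 0# ≡ x
  +-identityʳ x = trans (+-comm x 0#) (+-identityˡ x)

  -‿inverseʳ : ∀ x → x + - x ≡ 0#
  -‿inverseʳ x = trans (+-comm x (- x)) (-‿inverseˡ x)

  *-identityʳ : ∀ x → x * 1# ≡ x
  *-identityʳ x = trans (*-comm x 1#) (*-identityˡ x)

  distribʳ : ∀ x y z → (y + z) * x ≡ y * x + z * x
  distribʳ x y z = trans (*-comm (y + z) x) (trans (distribˡ x y z) (cong₂ _+_ (*-comm x y) (*-comm x z)))

  isCommutativeRing : IsCommutativeRing _≡_ _+_ _*_ -_ 0# 1#
  isCommutativeRing = record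
    { isRing = record
      { +-isAbelianGroup = record
        { isGroup = record
          { isMonoid = record
            { isSemigroup = record
              { isMagma = record { isEquivalence = isEquivalence ; ∙-cong = cong₂ _+_ }
              ; assoc = +-assoc }
            ; identity = +-identityˡ , +-identityʳ }
          ; inverse = -‿inverseˡ , -‿inverseʳ
          ; ⁻¹-cong = cong (λ x → - x) }
        ; comm = +-comm }
      ; *-cong = cong₂ _*_
      ; *-assoc = *-assoc
      ; *-identity = *-identityˡ , *-identityʳ
      ; distrib = distribˡ , distribʳ }
    ; *-comm = *-comm }

  commutativeRing : CommutativeRing 0ℓ 0ℓ
  commutativeRing = record { isCommutativeRing = isCommutativeRing }

  open CommutativeRing commutativeRing public using (zeroˡ; zeroʳ; semiring; ring)
  open import Algebra.Properties.Ring ring public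
    using (-‿involutive; -0#≈0#; -‿distribˡ-*; -‿distribʳ-*; -‿+-comm)

  module ℤ-Solver where
    open import Algebra.Properties.Semiring.Mult semiring
      using (×-homo-+; ×1-homo-*) renaming (_×_ to _×ℕ_)

    ι : ℕ → ℝ
    ι n = n ×ℕ 1#

    ⟦_⟧ : ℤ → ℝ
    ⟦ ℤ.+ n ⟧ = ι n
    ⟦ -[1+ n ] ⟧ = - ι (suc n)

    ⊖-homo : ∀ m n → ⟦ m ⊖ n ⟧ ≡ ι m - ι n
    ⊖-homo m zero = sym (trans (cong (ι m +_) -0#≈0#) (+-identityʳ (ι m)))
    ⊖-homo zero (suc n) = sym (+-identityˡ _)
    ⊖-homo (suc m) (suc n) = begin
      ⟦ suc m ⊖ suc n ⟧        ≡⟨ cong ⟦_⟧ (ℤ.[1+m]⊖[1+n]≡m⊖n m n) ⟩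
      ⟦ m ⊖ n ⟧                ≡⟨ ⊖-homo m n ⟩
      ι m - ι n                ≡⟨ sym (cancel-1# (ι m) (ι n)) ⟩
      ι (suc m) - ι (suc n)    ∎
      where
      open ≡-Reasoning
      cancel-1# : ∀ x y → (1# + x) - (1# + y) ≡ x - y
      cancel-1# x y = begin
        (1# + x) + - (1# + y)      ≡⟨ cong ((1# + x) +_) (sym (-‿+-comm 1# y)) ⟩
        (1# + x) + (- 1# + - y)    ≡⟨ sym (+-assoc (1# + x) (- 1#) (- y)) ⟩
        ((1# + x) + - 1#) + - y    ≡⟨ cong (_+ - y) (+-comm (1# + x) (- 1#)) ⟩
        (- 1# + (1# + x)) + - y    ≡⟨ cong (_+ - y) (sym (+-assoc (- 1#) 1# x)) ⟩
        ((- 1# + 1#) + x) + - y    ≡⟨ cong (λ t → (t + x) + - y) (-‿inverseˡ 1#) ⟩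
        (0# + x) + - y             ≡⟨ cong (_+ - y) (+-identityˡ x) ⟩
        x - y                      ∎

    -‿homo : ∀ i → ⟦ ℤ.- i ⟧ ≡ - ⟦ i ⟧
    -‿homo (ℤ.+ zero) = sym -0#≈0#
    -‿homo (ℤ.+ suc n) = refl
    -‿homo -[1+ n ] = sym (-‿involutive _)

    +-homo : ∀ i j → ⟦ i ℤ.+ j ⟧ ≡ ⟦ i ⟧ + ⟦ j ⟧
    +-homo -[1+ m ] -[1+ n ] = begin
      - ι (suc (suc (m ℕ.+ n)))      ≡⟨ cong (λ k → - ι (suc k)) (sym (ℕ.+-suc m n)) ⟩
      - ι (suc m ℕ.+ suc n)          ≡⟨ cong -_ (×-homo-+ 1# (suc m) (suc n)) ⟩
      - (ι (suc m) + ι (suc n))      ≡⟨ sym (-‿+-comm (ι (suc m)) (ι (suc n))) ⟩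
      - ι (suc m) + - ι (suc n)      ∎
      where open ≡-Reasoning
    +-homo -[1+ m ] (ℤ.+ n) = trans (⊖-homo n (suc m)) (+-comm _ _)
    +-homo (ℤ.+ m) -[1+ n ] = ⊖-homo m (suc n)
    +-homo (ℤ.+ m) (ℤ.+ n) = ×-homo-+ 1# m n

    -◃-homo : ∀ k → ⟦ Sign.- ℤ.◃ k ⟧ ≡ - ι k
    -◃-homo k = trans (cong ⟦_⟧ (ℤ.-◃n≡-n k)) (-‿homo (ℤ.+ k))

    *-homo : ∀ i j → ⟦ i ℤ.* j ⟧ ≡ ⟦ i ⟧ * ⟦ j ⟧
    *-homo (ℤ.+ m) (ℤ.+ n) = trans (cong ⟦_⟧ (ℤ.+◃n≡+n (m ℕ.* n))) (×1-homo-* m n)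
    *-homo (ℤ.+ m) -[1+ n ] =
      trans (-◃-homo (m ℕ.* suc n)) (trans (cong -_ (×1-homo-* m (suc n))) (-‿distribʳ-* _ _))
    *-homo -[1+ m ] (ℤ.+ n) =
      trans (-◃-homo (suc m ℕ.* n)) (trans (cong -_ (×1-homo-* (suc m) n)) (-‿distribˡ-* _ _))
    *-homo -[1+ m ] -[1+ n ] = begin
      ι (suc m ℕ.* suc n)               ≡⟨ ×1-homo-* (suc m) (suc n) ⟩
      ι (suc m) * ι (suc n)             ≡⟨ sym (-‿involutive _) ⟩
      - - (ι (suc m) * ι (suc n))       ≡⟨ cong -_ (-‿distribʳ-* _ _) ⟩
      - (ι (suc m) * - ι (suc n))       ≡⟨ -‿distribˡ-* _ _ ⟩
      - ι (suc m) * - ι (suc n)         ∎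
      where open ≡-Reasoning

    homomorphism : ACR._-Raw-AlmostCommutative⟶_ ℤ.+-*-rawRing (ACR.fromCommutativeRing commutativeRing)
    homomorphism = record
      { ⟦_⟧ = ⟦_⟧ ; +-homo = +-homo ; *-homo = *-homo ; -‿homo = -‿homo
      ; 0-homo = refl ; 1-homo = +-identityʳ 1# }

    ⟦⟧-≟ : ∀ i j → Maybe (⟦ i ⟧ ≡ ⟦ j ⟧)
    ⟦⟧-≟ i j with i ℤ.≟ j
    ... | yes refl = just refl
    ... | no _ = nothing

    open import Algebra.Solver.Ring ℤ.+-*-rawRing (ACR.fromCommutativeRing commutativeRing) homomorphism ⟦⟧-≟ public
      using (solve; _:=_; _:+_; _:*_; :-_; _:-_; con; Polynomial)

  open ℤ-Solver public using (solve; _:=_; _:+_; _:*_; :-_; _:-_; con; Polynomial)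

  private
    variable
      x y z u w c : ℝ

  x+y≡0⇒x≡-y : x + y ≡ 0# → x ≡ - y
  x+y≡0⇒x≡-y {x} {y} x+y≡0 = begin
    x                ≡⟨ solve 2 (λ x y → x := (x :+ y) :- y) refl x y ⟩
    (x + y) - y      ≡⟨ cong (_- y) x+y≡0 ⟩
    0# - y           ≡⟨ +-identityˡ (- y) ⟩
    - y              ∎
    where open ≡-Reasoning

  x-y≡0⇒x≡y : x - y ≡ 0# → x ≡ y
  x-y≡0⇒x≡y {x} {y} x-y≡0 = trans (x+y≡0⇒x≡-y x-y≡0) (-‿involutive y)

  x≡y+z⇒x-y≡z : x ≡ y + z → x - y ≡ z
  x≡y+z⇒x-y≡z {x} {y} {z} refl = solve 2 (λ y z → y :+ z :- y := z) refl y z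

  -x≡0⇒x≡0 : - x ≡ 0# → x ≡ 0#
  -x≡0⇒x≡0 {x} -x≡0 = trans (sym (-‿involutive x)) (trans (cong -_ -x≡0) -0#≈0#)

  inv : ∀ x → x ≢ 0# → ℝ
  inv x x≢0 = proj₁ (inverse x x≢0)

  *-inverseʳ : ∀ x (x≢0 : x ≢ 0#) → x * inv x x≢0 ≡ 1#
  *-inverseʳ x x≢0 = proj₂ (inverse x x≢0)

  *-cancelʳ-invertible : y * x ≡ z → x * u ≡ 1# → y ≡ z * u
  *-cancelʳ-invertible {y} {x} {z} {u} yx≡z xu≡1 = begin
    y             ≡⟨ sym (*-identityʳ y) ⟩
    y * 1#        ≡⟨ cong (y *_) (sym xu≡1) ⟩
    y * (x * u)   ≡⟨ sym (*-assoc y x u) ⟩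
    y * x * u     ≡⟨ cong (_* u) yx≡z ⟩
    z * u         ∎
    where open ≡-Reasoning

  *-cancelˡ-nonzero : (x≢0 : x ≢ 0#) → x * y ≡ z → y ≡ inv x x≢0 * z
  *-cancelˡ-nonzero {x} {y} {z} x≢0 xy≡z =
    trans (*-cancelʳ-invertible (trans (*-comm y x) xy≡z) (*-inverseʳ x x≢0)) (*-comm z (inv x x≢0))

  x*y≡0⇒y≡0 : x ≢ 0# → x * y ≡ 0# → y ≡ 0#
  x*y≡0⇒y≡0 x≢0 xy≡0 = trans (*-cancelˡ-nonzero x≢0 xy≡0) (zeroʳ _)

  *-nonzero : x ≢ 0# → y ≢ 0# → x * y ≢ 0#
  *-nonzero x≢0 y≢0 xy≡0 = y≢0 (x*y≡0⇒y≡0 x≢0 xy≡0)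

  inv-nonzero : (x≢0 : x ≢ 0#) → inv x x≢0 ≢ 0#
  inv-nonzero {x} x≢0 x⁻¹≡0 = 0≢1 (begin
    0#             ≡⟨ sym (zeroʳ x) ⟩
    x * 0#         ≡⟨ cong (x *_) (sym x⁻¹≡0) ⟩
    x * inv x x≢0  ≡⟨ *-inverseʳ x x≢0 ⟩
    1#             ∎)
    where open ≡-Reasoning

  inv-unique : x * y ≡ 1# → x * z ≡ 1# → y ≡ z
  inv-unique {x} {y} {z} xy≡1 xz≡1 =
    trans (*-cancelʳ-invertible (trans (*-comm y x) xy≡1) xz≡1) (*-identityˡ z)

  inv-cong : x ≡ y → (x≢0 : x ≢ 0#) (y≢0 : y ≢ 0#) → inv x x≢0 ≡ inv y y≢0
  inv-cong {x} refl x≢0 x≢0′ = inv-unique (*-inverseʳ x x≢0) (*-inverseʳ x x≢0′)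

  ≤-reflexive : x ≡ y → x ≤ y
  ≤-reflexive refl = ≤-refl _

  +-monoʳ-≤ : ∀ z → x ≤ y → z + x ≤ z + y
  +-monoʳ-≤ {x} {y} z x≤y = subst₂ _≤_ (+-comm x z) (+-comm y z) (+-mono-≤ z x≤y)

  +-mono-≤₂ : x ≤ y → u ≤ w → x + u ≤ y + w
  +-mono-≤₂ {y = y} {u = u} x≤y u≤w = ≤-trans (+-mono-≤ u x≤y) (+-monoʳ-≤ y u≤w)

  +-nonneg : 0# ≤ x → 0# ≤ y → 0# ≤ x + y
  +-nonneg 0≤x 0≤y = subst (_≤ _) (+-identityˡ 0#) (+-mono-≤₂ 0≤x 0≤y)

  +-nonneg-≡0ʳ : 0# ≤ x → 0# ≤ y → x + y ≡ 0# → y ≡ 0#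
  +-nonneg-≡0ʳ {x} {y} 0≤x 0≤y x+y≡0 =
    ≤-antisym (subst₂ _≤_ (+-identityˡ y) x+y≡0 (+-mono-≤ y 0≤x)) 0≤y

  -‿antimono-≤ : x ≤ y → - y ≤ - x
  -‿antimono-≤ {x} {y} x≤y = subst₂ _≤_
    (solve 2 (λ x y → x :+ (:- x :+ :- y) := :- y) refl x y)
    (solve 2 (λ x y → y :+ (:- x :+ :- y) := :- x) refl x y)
    (+-mono-≤ (- x + - y) x≤y)

  x≤0⇒0≤-x : x ≤ 0# → 0# ≤ - x
  x≤0⇒0≤-x {x} x≤0 = subst (_≤ - x) -0#≈0# (-‿antimono-≤ x≤0)

  0≤x⇒-x≤0 : 0# ≤ x → - x ≤ 0#
  0≤x⇒-x≤0 {x} 0≤x = subst (- x ≤_) -0#≈0# (-‿antimono-≤ 0≤x)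

  x≤y⇒0≤y-x : x ≤ y → 0# ≤ y - x
  x≤y⇒0≤y-x {x} {y} x≤y = subst (_≤ y - x) (-‿inverseʳ x) (+-mono-≤ (- x) x≤y)

  0≤y-x⇒x≤y : 0# ≤ y - x → x ≤ y
  0≤y-x⇒x≤y {y} {x} 0≤y-x = subst₂ _≤_ (+-identityˡ x)
    (solve 2 (λ y x → (y :- x) :+ x := y) refl y x) (+-mono-≤ x 0≤y-x)

  *-monoˡ-≤-nonneg : 0# ≤ c → x ≤ y → c * x ≤ c * y
  *-monoˡ-≤-nonneg {c} {x} {y} 0≤c x≤y = 0≤y-x⇒x≤y (subst (0# ≤_)
    (solve 3 (λ c x y → c :* (y :- x) := c :* y :- c :* x) refl c x y)
    (*-nonneg 0≤c (x≤y⇒0≤y-x x≤y)))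

  *-monoˡ-≤-nonpos : c ≤ 0# → x ≤ y → c * y ≤ c * x
  *-monoˡ-≤-nonpos {c} {x} {y} c≤0 x≤y = subst₂ _≤_
    (solve 2 (λ c y → :- (:- c :* y) := c :* y) refl c y)
    (solve 2 (λ c x → :- (:- c :* x) := c :* x) refl c x)
    (-‿antimono-≤ (*-monoˡ-≤-nonneg (x≤0⇒0≤-x c≤0) x≤y))

  0≤x*x : ∀ x → 0# ≤ x * x
  0≤x*x x with ≤-total 0# x
  ... | inj₁ 0≤x = *-nonneg 0≤x 0≤x
  ... | inj₂ x≤0 = subst (0# ≤_) (solve 1 (λ x → :- x :* :- x := x :* x) refl x)
    (*-nonneg (x≤0⇒0≤-x x≤0) (x≤0⇒0≤-x x≤0))

  upper-bound₂ : ∀ x y → ∃[ z ] x ≤ z × y ≤ z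
  upper-bound₂ x y with ≤-total x y
  ... | inj₁ x≤y = y , x≤y , ≤-refl y
  ... | inj₂ y≤x = x , ≤-refl x , y≤x

  0<x⇒x≢0 : 0# < x → x ≢ 0#
  0<x⇒x≢0 (_ , 0≢x) x≡0 = 0≢x (sym x≡0)

  0<x⇒¬x<0 : 0# < x → ¬ x < 0#
  0<x⇒¬x<0 (0≤x , 0≢x) (x≤0 , _) = 0≢x (≤-antisym 0≤x x≤0)

  x≢0⇒0<x⊎x<0 : x ≢ 0# → 0# < x ⊎ x < 0#
  x≢0⇒0<x⊎x<0 {x} x≢0 with ≤-total 0# x
  ... | inj₁ 0≤x = inj₁ (0≤x , λ 0≡x → x≢0 (sym 0≡x))
  ... | inj₂ x≤0 = inj₂ (x≤0 , x≢0)

  0≤? : x ≡ 0# ⊎ x ≢ 0# → Dec (0# ≤ x)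
  0≤? (inj₁ x≡0) = yes (≤-reflexive (sym x≡0))
  0≤? (inj₂ x≢0) with x≢0⇒0<x⊎x<0 x≢0
  ... | inj₁ 0<x = yes (proj₁ 0<x)
  ... | inj₂ x<0 = no (λ 0≤x → x≢0 (≤-antisym (proj₁ x<0) 0≤x))

  ≤0? : x ≡ 0# ⊎ x ≢ 0# → Dec (x ≤ 0#)
  ≤0? (inj₁ x≡0) = yes (≤-reflexive x≡0)
  ≤0? (inj₂ x≢0) with x≢0⇒0<x⊎x<0 x≢0
  ... | inj₁ 0<x = no (λ x≤0 → x≢0 (≤-antisym x≤0 (proj₁ 0<x)))
  ... | inj₂ x<0 = yes (proj₁ x<0)

  0<? : x ≡ 0# ⊎ x ≢ 0# → Dec (0# < x)
  0<? (inj₁ x≡0) = no (λ 0<x → 0<x⇒x≢0 0<x x≡0)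
  0<? (inj₂ x≢0) with x≢0⇒0<x⊎x<0 x≢0
  ... | inj₁ 0<x = yes 0<x
  ... | inj₂ x<0 = no (λ 0<x → 0<x⇒¬x<0 0<x x<0)

  0<1 : 0# < 1#
  0<1 = subst (0# ≤_) (*-identityˡ 1#) (0≤x*x 1#) , 0≢1

  neg-positive : 0# < x → - x < 0#
  neg-positive (0≤x , 0≢x) = 0≤x⇒-x≤0 0≤x , λ -x≡0 → 0≢x (sym (-x≡0⇒x≡0 -x≡0))

  neg-negative : x < 0# → 0# < - x
  neg-negative (x≤0 , x≢0) = x≤0⇒0≤-x x≤0 , λ 0≡-x → x≢0 (-x≡0⇒x≡0 (sym 0≡-x))

  +-positive-nonneg : 0# < x → 0# ≤ y → 0# < x + y
  +-positive-nonneg {x} {y} (0≤x , 0≢x) 0≤y =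
    ≤-trans 0≤x x≤x+y , λ 0≡x+y → 0≢x (≤-antisym 0≤x (subst (x ≤_) (sym 0≡x+y) x≤x+y))
    where
    x≤x+y : x ≤ x + y
    x≤x+y = subst (_≤ x + y) (+-identityʳ x) (+-monoʳ-≤ x 0≤y)

  *-positive : 0# < x → 0# < y → 0# < x * y
  *-positive 0<x 0<y =
    *-nonneg (proj₁ 0<x) (proj₁ 0<y) , λ 0≡xy → *-nonzero (0<x⇒x≢0 0<x) (0<x⇒x≢0 0<y) (sym 0≡xy)

  *-negative-positive : x < 0# → 0# < y → x * y < 0#
  *-negative-positive {x} {y} x<0 0<y = subst (_< 0#)
    (solve 2 (λ x y → :- (:- x :* y) := x :* y) refl x y)
    (neg-positive (*-positive (neg-negative x<0) 0<y))

  inv-positive : (0<x : 0# < x) → 0# < inv x (0<x⇒x≢0 0<x)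
  inv-positive {x} 0<x with x≢0⇒0<x⊎x<0 (inv-nonzero (0<x⇒x≢0 0<x))
  ... | inj₁ 0<x⁻¹ = 0<x⁻¹
  ... | inj₂ x⁻¹<0 = ⊥-elim (0<x⇒¬x<0 0<1
    (subst (_< 0#) (trans (*-comm _ x) (*-inverseʳ x (0<x⇒x≢0 0<x))) (*-negative-positive x⁻¹<0 0<x)))

  inv-negative : (x<0 : x < 0#) → inv x (proj₂ x<0) < 0#
  inv-negative {x} x<0 with x≢0⇒0<x⊎x<0 (inv-nonzero (proj₂ x<0))
  ... | inj₂ x⁻¹<0 = x⁻¹<0
  ... | inj₁ 0<x⁻¹ = ⊥-elim (0<x⇒¬x<0 0<1
    (subst (_< 0#) (*-inverseʳ x (proj₂ x<0)) (*-negative-positive x<0 0<x⁻¹)))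

  -- The sign argument behind the transitivity of angular orders around a point.
  combination-positive : ∀ {A B C a b c} → A * b ≡ B * c + C * a →
    0# ≤ a → 0# ≤ b → 0# ≤ c → (a ≡ 0# → b ≢ 0#) → A ≢ 0# → 0# < B → 0# < C → 0# < A
  combination-positive {A} {B} {C} {a} {b} {c} Ab≡Bc+Ca 0≤a 0≤b 0≤c a≡0⇒b≢0 A≢0 0<B 0<C
    with x≢0⇒0<x⊎x<0 A≢0
  ... | inj₁ 0<A = 0<A
  ... | inj₂ A<0 = ⊥-elim (a≡0⇒b≢0 a≡0 b≡0)
    where
    0≤Bc : 0# ≤ B * c
    0≤Bc = *-nonneg (proj₁ 0<B) 0≤c
    0≤Ca : 0# ≤ C * a
    0≤Ca = *-nonneg (proj₁ 0<C) 0≤a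
    Ab≡0 : A * b ≡ 0#
    Ab≡0 = ≤-antisym (subst (A * b ≤_) (zeroʳ A) (*-monoˡ-≤-nonpos (proj₁ A<0) 0≤b))
                     (subst (0# ≤_) (sym Ab≡Bc+Ca) (+-nonneg 0≤Bc 0≤Ca))
    b≡0 : b ≡ 0#
    b≡0 = x*y≡0⇒y≡0 A≢0 Ab≡0
    a≡0 : a ≡ 0#
    a≡0 = x*y≡0⇒y≡0 (0<x⇒x≢0 0<C) (+-nonneg-≡0ʳ 0≤Bc 0≤Ca (trans (sym Ab≡Bc+Ca) Ab≡0))

module PlaneIdentities (R : Reals) where
  open Reals R
  open RealsProperties R
  open Geometry R

  private
    Poly² : ℕ → Set
    Poly² m = Polynomial m × Polynomial m

    _:-²_ : ∀ {m} → Poly² m → Poly² m → Poly² m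
    (a , b) :-² (c , d) = (a :- c , b :- d)

    Inner Det : ∀ {m} → Poly² m → Poly² m → Polynomial m
    Inner (a , b) (c , d) = a :* c :+ b :* d
    Det (a , b) (c , d) = a :* d :- b :* c

    Orient : ∀ {m} → Poly² m → Poly² m → Poly² m → Polynomial m
    Orient x y z = Det (y :-² x) (z :-² x)

  orient-rotate : ∀ x y z → orient x y z ≡ orient y z x
  orient-rotate (x₁ , x₂) (y₁ , y₂) (z₁ , z₂) = solve 6 (λ x₁ x₂ y₁ y₂ z₁ z₂ →
    let x = (x₁ , x₂); y = (y₁ , y₂); z = (z₁ , z₂) in
    Orient x y z := Orient y z x) refl x₁ x₂ y₁ y₂ z₁ z₂

  orient-swapˡ : ∀ x y z → orient y x z ≡ - orient x y z
  orient-swapˡ (x₁ , x₂) (y₁ , y₂) (z₁ , z₂) = solve 6 (λ x₁ x₂ y₁ y₂ z₁ z₂ →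
    let x = (x₁ , x₂); y = (y₁ , y₂); z = (z₁ , z₂) in
    Orient y x z := :- Orient x y z) refl x₁ x₂ y₁ y₂ z₁ z₂

  orient-swapʳ : ∀ x y z → orient x z y ≡ - orient x y z
  orient-swapʳ (x₁ , x₂) (y₁ , y₂) (z₁ , z₂) = solve 6 (λ x₁ x₂ y₁ y₂ z₁ z₂ →
    let x = (x₁ , x₂); y = (y₁ , y₂); z = (z₁ , z₂) in
    Orient x z y := :- Orient x y z) refl x₁ x₂ y₁ y₂ z₁ z₂

  orient-xyx≡0 : ∀ x y → orient x y x ≡ 0#
  orient-xyx≡0 (x₁ , x₂) (y₁ , y₂) = solve 4 (λ x₁ x₂ y₁ y₂ →
    let x = (x₁ , x₂); y = (y₁ , y₂) in
    Orient x y x := con (ℤ.+ 0)) refl x₁ x₂ y₁ y₂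

  orient-xyy≡0 : ∀ x y → orient x y y ≡ 0#
  orient-xyy≡0 (x₁ , x₂) (y₁ , y₂) = solve 4 (λ x₁ x₂ y₁ y₂ →
    let x = (x₁ , x₂); y = (y₁ , y₂) in
    Orient x y y := con (ℤ.+ 0)) refl x₁ x₂ y₁ y₂

  orient-horizontal : ∀ o a b → proj₂ a - proj₂ o ≡ 0# → proj₂ b - proj₂ o ≡ 0# → orient o a b ≡ 0#
  orient-horizontal (o₁ , o₂) (a₁ , a₂) (b₁ , b₂) a≡0 b≡0 = begin
    (a₁ - o₁) * (b₂ - o₂) - (a₂ - o₂) * (b₁ - o₁)
      ≡⟨ cong₂ (λ s t → (a₁ - o₁) * t - s * (b₁ - o₁)) a≡0 b≡0 ⟩
    (a₁ - o₁) * 0# - 0# * (b₁ - o₁)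
      ≡⟨ solve 2 (λ s t → s :* con (ℤ.+ 0) :- con (ℤ.+ 0) :* t := con (ℤ.+ 0)) refl (a₁ - o₁) (b₁ - o₁) ⟩
    0# ∎
    where open ≡-Reasoning

  orient-split : ∀ z x y w → orient x y w ≡ orient z y w + orient z w x + orient z x y
  orient-split (z₁ , z₂) (x₁ , x₂) (y₁ , y₂) (w₁ , w₂) = solve 8 (λ z₁ z₂ x₁ x₂ y₁ y₂ w₁ w₂ →
    let z = (z₁ , z₂); x = (x₁ , x₂); y = (y₁ , y₂); w = (w₁ , w₂) in
    Orient x y w := Orient z y w :+ Orient z w x :+ Orient z x y) refl z₁ z₂ x₁ x₂ y₁ y₂ w₁ w₂

  -- Each exchange identity is det(A,C) B = det(A,B) C + det(B,C) A, for the vectors A, B, C from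
  -- the base point to a, b, c, evaluated under a linear functional.
  orient-exchange-tail : ∀ u w a b c →
    orient w a c * orient u w b ≡ orient w a b * orient u w c + orient w b c * orient u w a
  orient-exchange-tail (u₁ , u₂) (w₁ , w₂) (a₁ , a₂) (b₁ , b₂) (c₁ , c₂) =
    solve 10 (λ u₁ u₂ w₁ w₂ a₁ a₂ b₁ b₂ c₁ c₂ →
      let u = (u₁ , u₂); w = (w₁ , w₂); a = (a₁ , a₂); b = (b₁ , b₂); c = (c₁ , c₂) in
      Orient w a c :* Orient u w b := Orient w a b :* Orient u w c :+ Orient w b c :* Orient u w a)
      refl u₁ u₂ w₁ w₂ a₁ a₂ b₁ b₂ c₁ c₂

  orient-exchange-head : ∀ u w a b c →
    orient u a c * orient u w b ≡ orient u a b * orient u w c + orient u b c * orient u w a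
  orient-exchange-head (u₁ , u₂) (w₁ , w₂) (a₁ , a₂) (b₁ , b₂) (c₁ , c₂) =
    solve 10 (λ u₁ u₂ w₁ w₂ a₁ a₂ b₁ b₂ c₁ c₂ →
      let u = (u₁ , u₂); w = (w₁ , w₂); a = (a₁ , a₂); b = (b₁ , b₂); c = (c₁ , c₂) in
      Orient u a c :* Orient u w b := Orient u a b :* Orient u w c :+ Orient u b c :* Orient u w a)
      refl u₁ u₂ w₁ w₂ a₁ a₂ b₁ b₂ c₁ c₂

  orient-exchange-ordinate : ∀ o a b c →
    orient o a c * (proj₂ b - proj₂ o) ≡ orient o a b * (proj₂ c - proj₂ o) + orient o b c * (proj₂ a - proj₂ o)
  orient-exchange-ordinate (o₁ , o₂) (a₁ , a₂) (b₁ , b₂) (c₁ , c₂) =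
    solve 8 (λ o₁ o₂ a₁ a₂ b₁ b₂ c₁ c₂ →
      let o = (o₁ , o₂); a = (a₁ , a₂); b = (b₁ , b₂); c = (c₁ , c₂) in
      Orient o a c :* (b₂ :- o₂) := Orient o a b :* (c₂ :- o₂) :+ Orient o b c :* (a₂ :- o₂))
      refl o₁ o₂ a₁ a₂ b₁ b₂ c₁ c₂

  inner-swap : ∀ x y vx vy → ⟨ x -² y , vx -² vy ⟩ ≡ ⟨ y -² x , vy -² vx ⟩
  inner-swap (x₁ , x₂) (y₁ , y₂) (vx₁ , vx₂) (vy₁ , vy₂) = solve 8 (λ x₁ x₂ y₁ y₂ vx₁ vx₂ vy₁ vy₂ →
    let x = (x₁ , x₂); y = (y₁ , y₂); vx = (vx₁ , vx₂); vy = (vy₁ , vy₂) in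
    Inner (x :-² y) (vx :-² vy) := Inner (y :-² x) (vy :-² vx)) refl x₁ x₂ y₁ y₂ vx₁ vx₂ vy₁ vy₂

  inner-self : ∀ x vx → ⟨ x -² x , vx -² vx ⟩ ≡ 0#
  inner-self (x₁ , x₂) (vx₁ , vx₂) = solve 4 (λ x₁ x₂ vx₁ vx₂ →
    let x = (x₁ , x₂); vx = (vx₁ , vx₂) in
    Inner (x :-² x) (vx :-² vx) := con (ℤ.+ 0)) refl x₁ x₂ vx₁ vx₂

  inner-distribˡ-sub : ∀ s x y → ⟨ s , x -² y ⟩ ≡ ⟨ s , x ⟩ - ⟨ s , y ⟩
  inner-distribˡ-sub (s₁ , s₂) (x₁ , x₂) (y₁ , y₂) = solve 6 (λ s₁ s₂ x₁ x₂ y₁ y₂ →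
    let s = (s₁ , s₂); x = (x₁ , x₂); y = (y₁ , y₂) in
    Inner s (x :-² y) := Inner s x :- Inner s y) refl s₁ s₂ x₁ x₂ y₁ y₂

  ∥_∥² : ℝ² → ℝ
  ∥ u ∥² = ⟨ u , u ⟩

  lagrange : ∀ s t → det s t * det s t + ⟨ s , t ⟩ * ⟨ s , t ⟩ ≡ ∥ s ∥² * ∥ t ∥²
  lagrange (s₁ , s₂) (t₁ , t₂) = solve 4 (λ s₁ s₂ t₁ t₂ → let s = (s₁ , s₂); t = (t₁ , t₂) in
    Det s t :* Det s t :+ Inner s t :* Inner s t := Inner s s :* Inner t t) refl s₁ s₂ t₁ t₂

  det≢0⇒∥∥²≢0 : ∀ s t → det s t ≢ 0# → ∥ s ∥² ≢ 0#
  det≢0⇒∥∥²≢0 s t det≢0 ∥s∥²≡0 = *-nonzero det≢0 det≢0 det²≡0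
    where
    det²≡0 : det s t * det s t ≡ 0#
    det²≡0 = +-nonneg-≡0ʳ (0≤x*x ⟨ s , t ⟩) (0≤x*x (det s t))
      (trans (+-comm _ _) (trans (lagrange s t) (trans (cong (_* ∥ t ∥²) ∥s∥²≡0) (zeroˡ _))))

  cramer₁ : ∀ s t u → det s t * proj₁ u ≡ proj₂ t * ⟨ s , u ⟩ - proj₂ s * ⟨ t , u ⟩
  cramer₁ (s₁ , s₂) (t₁ , t₂) (u₁ , u₂) = solve 6 (λ s₁ s₂ t₁ t₂ u₁ u₂ →
    let s = (s₁ , s₂); t = (t₁ , t₂); u = (u₁ , u₂) in
    Det s t :* u₁ := t₂ :* Inner s u :- s₂ :* Inner t u) refl s₁ s₂ t₁ t₂ u₁ u₂

  cramer₂ : ∀ s t u → det s t * proj₂ u ≡ proj₁ s * ⟨ t , u ⟩ - proj₁ t * ⟨ s , u ⟩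
  cramer₂ (s₁ , s₂) (t₁ , t₂) (u₁ , u₂) = solve 6 (λ s₁ s₂ t₁ t₂ u₁ u₂ →
    let s = (s₁ , s₂); t = (t₁ , t₂); u = (u₁ , u₂) in
    Det s t :* u₂ := s₁ :* Inner t u :- t₁ :* Inner s u) refl s₁ s₂ t₁ t₂ u₁ u₂

  -- l₀ p z + l₁ p x + l₂ p y + l₃ p w = 0 with l₀ + l₁ + l₂ + l₃ = 0 is the affine dependence of
  -- four points, and the products lᵢ lⱼ form an equilibrium stress of the complete graph on them.
  stress-K4 : ∀ z x y w vz vx vy vw →
    let l₀ = - orient x y w; l₁ = orient z y w; l₂ = orient z w x; l₃ = orient z x y in
    l₀ * l₁ * ⟨ z -² x , vz -² vx ⟩
      + (l₀ * l₂ * ⟨ z -² y , vz -² vy ⟩ + l₀ * l₃ * ⟨ z -² w , vz -² vw ⟩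
         + l₁ * l₂ * ⟨ x -² y , vx -² vy ⟩ + l₁ * l₃ * ⟨ x -² w , vx -² vw ⟩
         + l₂ * l₃ * ⟨ y -² w , vy -² vw ⟩) ≡ 0#
  stress-K4 (z₁ , z₂) (x₁ , x₂) (y₁ , y₂) (w₁ , w₂) (vz₁ , vz₂) (vx₁ , vx₂) (vy₁ , vy₂) (vw₁ , vw₂) =
    solve 16 (λ z₁ z₂ x₁ x₂ y₁ y₂ w₁ w₂ vz₁ vz₂ vx₁ vx₂ vy₁ vy₂ vw₁ vw₂ →
      let z = (z₁ , z₂); x = (x₁ , x₂); y = (y₁ , y₂); w = (w₁ , w₂)
          vz = (vz₁ , vz₂); vx = (vx₁ , vx₂); vy = (vy₁ , vy₂); vw = (vw₁ , vw₂)
          l₀ = :- Orient x y w; l₁ = Orient z y w; l₂ = Orient z w x; l₃ = Orient z x y in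
      l₀ :* l₁ :* Inner (z :-² x) (vz :-² vx)
        :+ (l₀ :* l₂ :* Inner (z :-² y) (vz :-² vy) :+ l₀ :* l₃ :* Inner (z :-² w) (vz :-² vw)
            :+ l₁ :* l₂ :* Inner (x :-² y) (vx :-² vy) :+ l₁ :* l₃ :* Inner (x :-² w) (vx :-² vw)
            :+ l₂ :* l₃ :* Inner (y :-² w) (vy :-² vw)) := con (ℤ.+ 0))
      refl z₁ z₂ x₁ x₂ y₁ y₂ w₁ w₂ vz₁ vz₂ vx₁ vx₂ vy₁ vy₂ vw₁ vw₂

  -- Decompose vz - vy along z - y and its normal, and vy - vx along y - x and its normal: the strain
  -- of the diagonal xz is that of the sides plus orient x y z times their difference in angular velocity.
  strain-diagonal : ∀ x y z vx vy vz {N⁻¹ M⁻¹} → ∥ y -² x ∥² * N⁻¹ ≡ 1# → ∥ z -² y ∥² * M⁻¹ ≡ 1# →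
    let exy = ⟨ x -² y , vx -² vy ⟩; eyz = ⟨ y -² z , vy -² vz ⟩ in
    ⟨ x -² z , vx -² vz ⟩
      ≡ exy + eyz + ⟨ y -² x , z -² y ⟩ * (N⁻¹ * exy + M⁻¹ * eyz)
        + orient x y z * (N⁻¹ * det (y -² x) (vy -² vx) - M⁻¹ * det (z -² y) (vz -² vy))
  strain-diagonal x@(x₁ , x₂) y@(y₁ , y₂) z@(z₁ , z₂) vx@(vx₁ , vx₂) vy@(vy₁ , vy₂) vz@(vz₁ , vz₂)
                  {N⁻¹} {M⁻¹} NN⁻¹≡1 MM⁻¹≡1 = begin
    ⟨ x -² z , vx -² vz ⟩                      ≡⟨ split ⟩
    exy + eyz + ⟨ x -² y , vy -² vz ⟩ + ⟨ y -² z , vx -² vy ⟩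
      ≡⟨ cong₂ (λ s t → exy + eyz + s + t) (*-cancelʳ-invertible cross₁ MM⁻¹≡1)
                                            (*-cancelʳ-invertible cross₂ NN⁻¹≡1) ⟩
    exy + eyz + (eyz * c - r′ * o) * M⁻¹ + (exy * c + r * o) * N⁻¹
      ≡⟨ solve 8 (λ exy eyz c o r r′ N⁻¹ M⁻¹ →
           exy :+ eyz :+ (eyz :* c :- r′ :* o) :* M⁻¹ :+ (exy :* c :+ r :* o) :* N⁻¹
             := exy :+ eyz :+ c :* (N⁻¹ :* exy :+ M⁻¹ :* eyz) :+ o :* (N⁻¹ :* r :- M⁻¹ :* r′))
           refl exy eyz c o r r′ N⁻¹ M⁻¹ ⟩
    exy + eyz + c * (N⁻¹ * exy + M⁻¹ * eyz) + o * (N⁻¹ * r - M⁻¹ * r′)  ∎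
    where
    open ≡-Reasoning
    exy = ⟨ x -² y , vx -² vy ⟩
    eyz = ⟨ y -² z , vy -² vz ⟩
    c = ⟨ y -² x , z -² y ⟩
    o = orient x y z
    r = det (y -² x) (vy -² vx)
    r′ = det (z -² y) (vz -² vy)
    split : ⟨ x -² z , vx -² vz ⟩ ≡ exy + eyz + ⟨ x -² y , vy -² vz ⟩ + ⟨ y -² z , vx -² vy ⟩
    split = solve 12 (λ x₁ x₂ y₁ y₂ z₁ z₂ vx₁ vx₂ vy₁ vy₂ vz₁ vz₂ →
      let x = (x₁ , x₂); y = (y₁ , y₂); z = (z₁ , z₂)
          vx = (vx₁ , vx₂); vy = (vy₁ , vy₂); vz = (vz₁ , vz₂) in
      Inner (x :-² z) (vx :-² vz)
        := Inner (x :-² y) (vx :-² vy) :+ Inner (y :-² z) (vy :-² vz)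
           :+ Inner (x :-² y) (vy :-² vz) :+ Inner (y :-² z) (vx :-² vy))
      refl x₁ x₂ y₁ y₂ z₁ z₂ vx₁ vx₂ vy₁ vy₂ vz₁ vz₂
    cross₁ : ⟨ x -² y , vy -² vz ⟩ * ∥ z -² y ∥² ≡ eyz * c - r′ * o
    cross₁ = solve 12 (λ x₁ x₂ y₁ y₂ z₁ z₂ vx₁ vx₂ vy₁ vy₂ vz₁ vz₂ →
      let x = (x₁ , x₂); y = (y₁ , y₂); z = (z₁ , z₂)
          vx = (vx₁ , vx₂); vy = (vy₁ , vy₂); vz = (vz₁ , vz₂) in
      Inner (x :-² y) (vy :-² vz) :* Inner (z :-² y) (z :-² y)
        := Inner (y :-² z) (vy :-² vz) :* Inner (y :-² x) (z :-² y) :- Det (z :-² y) (vz :-² vy) :* Orient x y z)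
      refl x₁ x₂ y₁ y₂ z₁ z₂ vx₁ vx₂ vy₁ vy₂ vz₁ vz₂
    cross₂ : ⟨ y -² z , vx -² vy ⟩ * ∥ y -² x ∥² ≡ exy * c + r * o
    cross₂ = solve 12 (λ x₁ x₂ y₁ y₂ z₁ z₂ vx₁ vx₂ vy₁ vy₂ vz₁ vz₂ →
      let x = (x₁ , x₂); y = (y₁ , y₂); z = (z₁ , z₂)
          vx = (vx₁ , vx₂); vy = (vy₁ , vy₂); vz = (vz₁ , vz₂) in
      Inner (y :-² z) (vx :-² vy) :* Inner (y :-² x) (y :-² x)
        := Inner (x :-² y) (vx :-² vy) :* Inner (y :-² x) (z :-² y) :+ Det (y :-² x) (vy :-² vx) :* Orient x y z)
      refl x₁ x₂ y₁ y₂ z₁ z₂ vx₁ vx₂ vy₁ vy₂ vz₁ vz₂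

module BoundedFunctions (R : Reals) {A : Set} (X : A → Set) where
  open Reals R
  open RealsProperties R
  open Geometry R using (ℝ²; ⟨_,_⟩; det)
  open PlaneIdentities R

  infix 4 _≈_

  _≈_ : (A → ℝ) → (A → ℝ) → Set
  g ≈ h = ∀ v → X v → g v ≡ h v

  BoundedBelow BoundedAbove Bounded : (A → ℝ) → Set
  BoundedBelow g = ∃[ L ] ∀ v → X v → L ≤ g v
  BoundedAbove g = ∃[ U ] ∀ v → X v → g v ≤ U
  Bounded g = BoundedBelow g × BoundedAbove g

  private
    variable
      g h : A → ℝ
      c : ℝ

  boundedBelow-cong : g ≈ h → BoundedBelow g → BoundedBelow h
  boundedBelow-cong g≈h (L , L≤g) = L , λ v x → subst (L ≤_) (g≈h v x) (L≤g v x)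

  boundedAbove-cong : g ≈ h → BoundedAbove g → BoundedAbove h
  boundedAbove-cong g≈h (U , g≤U) = U , λ v x → subst (_≤ U) (g≈h v x) (g≤U v x)

  bounded-cong : g ≈ h → Bounded g → Bounded h
  bounded-cong g≈h (below , above) = boundedBelow-cong g≈h below , boundedAbove-cong g≈h above

  bounded-const : ∀ c → Bounded (λ _ → c)
  bounded-const c = (c , λ _ _ → ≤-refl c) , (c , λ _ _ → ≤-refl c)

  boundedBelow-+ : BoundedBelow g → BoundedBelow h → BoundedBelow (λ v → g v + h v)
  boundedBelow-+ (L , L≤g) (L′ , L′≤h) = L + L′ , λ v x → +-mono-≤₂ (L≤g v x) (L′≤h v x)

  boundedAbove-+ : BoundedAbove g → BoundedAbove h → BoundedAbove (λ v → g v + h v)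
  boundedAbove-+ (U , g≤U) (U′ , h≤U′) = U + U′ , λ v x → +-mono-≤₂ (g≤U v x) (h≤U′ v x)

  bounded-+ : Bounded g → Bounded h → Bounded (λ v → g v + h v)
  bounded-+ (gL , gU) (hL , hU) = boundedBelow-+ gL hL , boundedAbove-+ gU hU

  boundedBelow-neg : BoundedAbove g → BoundedBelow (λ v → - g v)
  boundedBelow-neg (U , g≤U) = - U , λ v x → -‿antimono-≤ (g≤U v x)

  boundedAbove-neg : BoundedBelow g → BoundedAbove (λ v → - g v)
  boundedAbove-neg (L , L≤g) = - L , λ v x → -‿antimono-≤ (L≤g v x)

  bounded-neg : Bounded g → Bounded (λ v → - g v)
  bounded-neg (below , above) = boundedBelow-neg above , boundedAbove-neg below

  boundedBelow-*ˡ : 0# ≤ c → BoundedBelow g → BoundedBelow (λ v → c * g v)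
  boundedBelow-*ˡ {c} 0≤c (L , L≤g) = c * L , λ v x → *-monoˡ-≤-nonneg 0≤c (L≤g v x)

  boundedAbove-*ˡ : 0# ≤ c → BoundedAbove g → BoundedAbove (λ v → c * g v)
  boundedAbove-*ˡ {c} 0≤c (U , g≤U) = c * U , λ v x → *-monoˡ-≤-nonneg 0≤c (g≤U v x)

  boundedBelow-*ˡ-nonpos : c ≤ 0# → BoundedAbove g → BoundedBelow (λ v → c * g v)
  boundedBelow-*ˡ-nonpos {c} c≤0 (U , g≤U) = c * U , λ v x → *-monoˡ-≤-nonpos c≤0 (g≤U v x)

  boundedAbove-*ˡ-nonpos : c ≤ 0# → BoundedBelow g → BoundedAbove (λ v → c * g v)
  boundedAbove-*ˡ-nonpos {c} c≤0 (L , L≤g) = c * L , λ v x → *-monoˡ-≤-nonpos c≤0 (L≤g v x)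

  bounded-*ˡ : ∀ c → Bounded g → Bounded (λ v → c * g v)
  bounded-*ˡ c (below , above) with ≤-total 0# c
  ... | inj₁ 0≤c = boundedBelow-*ˡ 0≤c below , boundedAbove-*ˡ 0≤c above
  ... | inj₂ c≤0 = boundedBelow-*ˡ-nonpos c≤0 above , boundedAbove-*ˡ-nonpos c≤0 below

  bounded-÷ : c ≢ 0# → (λ v → c * g v) ≈ h → Bounded h → Bounded g
  bounded-÷ {c} c≢0 cg≈h bh =
    bounded-cong (λ v x → sym (*-cancelˡ-nonzero c≢0 (cg≈h v x))) (bounded-*ˡ (inv c c≢0) bh)

  boundedAbove-÷-negative : (c<0 : c < 0#) → (λ v → c * g v) ≈ h → BoundedBelow h → BoundedAbove g
  boundedAbove-÷-negative {c} c<0 cg≈h L≤h =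
    boundedAbove-cong (λ v x → sym (*-cancelˡ-nonzero (proj₂ c<0) (cg≈h v x)))
      (boundedAbove-*ˡ-nonpos (proj₁ (inv-negative c<0)) L≤h)

  boundedBelow-÷-positive : (0<c : 0# < c) → (λ v → c * g v) ≈ h → BoundedBelow h → BoundedBelow g
  boundedBelow-÷-positive {c} 0<c cg≈h L≤h =
    boundedBelow-cong (λ v x → sym (*-cancelˡ-nonzero (0<x⇒x≢0 0<c) (cg≈h v x)))
      (boundedBelow-*ˡ (proj₁ (inv-positive 0<c)) L≤h)

  bounded-inner : ∀ s {u : A → ℝ²} → Bounded (λ v → proj₁ (u v)) → Bounded (λ v → proj₂ (u v)) →
                  Bounded (λ v → ⟨ s , u v ⟩)
  bounded-inner (s₁ , s₂) bu₁ bu₂ = bounded-+ (bounded-*ˡ s₁ bu₁) (bounded-*ˡ s₂ bu₂)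

  bounded-cramer : ∀ s t {u : A → ℝ²} → det s t ≢ 0# →
    Bounded (λ v → ⟨ s , u v ⟩) → Bounded (λ v → ⟨ t , u v ⟩) →
    Bounded (λ v → proj₁ (u v)) × Bounded (λ v → proj₂ (u v))
  bounded-cramer s t {u} det≢0 bs bt =
    bounded-÷ det≢0 (λ v _ → cramer₁ s t (u v)) (bounded-+ (bounded-*ˡ _ bs) (bounded-neg (bounded-*ˡ _ bt))) ,
    bounded-÷ det≢0 (λ v _ → cramer₂ s t (u v)) (bounded-+ (bounded-*ˡ _ bt) (bounded-neg (bounded-*ˡ _ bs)))

  BoundedBy : ℝ → (A → ℝ) → Set
  BoundedBy M g = ∀ v → X v → - M ≤ g v × g v ≤ M

  boundedBy-mono : ∀ {M M′} → M ≤ M′ → BoundedBy M g → BoundedBy M′ g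
  boundedBy-mono M≤M′ g≤M v x =
    ≤-trans (-‿antimono-≤ M≤M′) (proj₁ (g≤M v x)) , ≤-trans (proj₂ (g≤M v x)) M≤M′

  bounded⇒boundedBy : Bounded g → ∃[ M ] BoundedBy M g
  bounded⇒boundedBy ((L , L≤g) , (U , g≤U)) with upper-bound₂ (- L) U
  ... | M , -L≤M , U≤M =
    M , λ v x → ≤-trans (subst (- M ≤_) (-‿involutive L) (-‿antimono-≤ -L≤M)) (L≤g v x)
              , ≤-trans (g≤U v x) U≤M

  boundedBy-finite : ∀ {m} (g : Fin m → A → ℝ) → (∀ i → Bounded (g i)) → ∃[ M ] ∀ i → BoundedBy M (g i)
  boundedBy-finite {zero} g bg = 0# , λ ()
  boundedBy-finite {suc m} g bg
    with bounded⇒boundedBy (bg Fin.zero) | boundedBy-finite (λ i → g (Fin.suc i)) (λ i → bg (Fin.suc i))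
  ... | M₀ , g₀≤M₀ | M , gs≤M with upper-bound₂ M₀ M
  ...   | M′ , M₀≤M′ , M≤M′ = M′ , λ
    { Fin.zero → boundedBy-mono M₀≤M′ g₀≤M₀
    ; (Fin.suc i) → boundedBy-mono M≤M′ (gs≤M i) }

  boundedBy-finite² : ∀ {m} (u : Fin m → A → ℝ²) →
    (∀ i → Bounded (λ v → proj₁ (u i v)) × Bounded (λ v → proj₂ (u i v))) →
    ∃[ M ] ∀ v → X v → ∀ i →
      (- M ≤ proj₁ (u i v)) × (proj₁ (u i v) ≤ M) × (- M ≤ proj₂ (u i v)) × (proj₂ (u i v) ≤ M)
  boundedBy-finite² u bu
    with boundedBy-finite (λ i v → proj₁ (u i v)) (λ i → proj₁ (bu i))
       | boundedBy-finite (λ i v → proj₂ (u i v)) (λ i → proj₂ (bu i))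
  ... | M₁ , u₁≤M₁ | M₂ , u₂≤M₂ with upper-bound₂ M₁ M₂
  ...   | M , M₁≤M , M₂≤M = M , λ v x i →
    proj₁ (boundedBy-mono M₁≤M (u₁≤M₁ i) v x) , proj₂ (boundedBy-mono M₁≤M (u₁≤M₁ i) v x) ,
    proj₁ (boundedBy-mono M₂≤M (u₂≤M₂ i) v x) , proj₂ (boundedBy-mono M₂≤M (u₂≤M₂ i) v x)

module ListMinimum {A : Set} (_≟_ : DecidableEquality A) (C : A → Set) (C? : Decidable C)
  (_≺_ : A → A → Set)
  (≺-total : ∀ {x y} → C x → C y → x ≢ y → x ≺ y ⊎ y ≺ x)
  (≺-trans : ∀ {x y z} → C x → C y → C z → x ≢ y → y ≢ z → x ≢ z → x ≺ y → y ≺ z → x ≺ z) where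

  Minimum : List A → A → Set
  Minimum xs c = C c × (∀ x → x ∈ xs → C x → x ≢ c → c ≺ x)

  minimum : ∀ xs → (∀ x → x ∈ xs → ¬ C x) ⊎ ∃ (Minimum xs)
  minimum [] = inj₁ (λ _ ())
  minimum (y ∷ xs) with minimum xs | C? y
  ... | inj₁ none | no ¬Cy = inj₁ λ { x (here refl) → ¬Cy ; x (there x∈xs) → none x x∈xs }
  ... | inj₁ none | yes Cy = inj₂ (y , Cy , λ
    { x (here refl) _ x≢y → ⊥-elim (x≢y refl)
    ; x (there x∈xs) Cx _ → ⊥-elim (none x x∈xs Cx) })
  ... | inj₂ (c , Cc , c≺) | no ¬Cy = inj₂ (c , Cc , λ
    { x (here refl) Cx _ → ⊥-elim (¬Cy Cx)
    ; x (there x∈xs) → c≺ x x∈xs })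
  ... | inj₂ (c , Cc , c≺) | yes Cy with y ≟ c
  ...   | yes refl = inj₂ (c , Cc , λ
    { x (here refl) _ x≢c → ⊥-elim (x≢c refl)
    ; x (there x∈xs) → c≺ x x∈xs })
  ...   | no y≢c with ≺-total Cc Cy (λ c≡y → y≢c (sym c≡y))
  ...     | inj₁ c≺y = inj₂ (c , Cc , λ
    { x (here refl) _ _ → c≺y
    ; x (there x∈xs) → c≺ x x∈xs })
  ...     | inj₂ y≺c = inj₂ (y , Cy , λ
    { x (here refl) _ x≢y → ⊥-elim (x≢y refl)
    ; x (there x∈xs) Cx x≢y → y≺x x∈xs Cx x≢y })
    where
    y≺x : ∀ {x} → x ∈ xs → C x → x ≢ y → y ≺ x
    y≺x {x} x∈xs Cx x≢y with x ≟ c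
    ... | yes refl = y≺c
    ... | no x≢c = ≺-trans Cy Cc Cx y≢c (λ c≡x → x≢c (sym c≡x)) (λ y≡x → x≢y (sym y≡x))
                     y≺c (c≺ x x∈xs Cx x≢c)

fin-third : ∀ {n} → 3 ℕ.≤ n → (i j : Fin n) → ∃[ k ] k ≢ i × k ≢ j
fin-third (s≤s (s≤s (s≤s _))) i j with i Fin.≟ j
... | yes refl = punchIn i Fin.zero , Fin.punchInᵢ≢i i _ , Fin.punchInᵢ≢i i _
... | no i≢j = punchIn i (punchIn j′ Fin.zero) , Fin.punchInᵢ≢i i _ , λ k≡j →
      Fin.punchInᵢ≢i j′ Fin.zero (Fin.punchIn-injective i _ _ (trans k≡j (sym (Fin.punchIn-punchOut i≢j))))
  where
  j′ = punchOut i≢j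

module ConvexHull (R : Reals) {n : ℕ} (3≤n : 3 ℕ.≤ n)
  (p : Fin n → Geometry.ℝ² R) (gp : Geometry.GeneralPosition R p) where
  open Reals R
  open RealsProperties R
  open Geometry R
  open PlaneIdentities R

  private
    variable
      i j k : Fin n

  Δ : Fin n → Fin n → Fin n → ℝ
  Δ i j k = orient (p i) (p j) (p k)

  Δ≡0⊎Δ≢0 : i ≢ j → ∀ k → Δ i j k ≡ 0# ⊎ Δ i j k ≢ 0#
  Δ≡0⊎Δ≢0 {i} {j} i≢j k with k Fin.≟ i | k Fin.≟ j
  ... | yes refl | _ = inj₁ (orient-xyx≡0 (p k) (p j))
  ... | no _ | yes refl = inj₁ (orient-xyy≡0 (p i) (p k))
  ... | no k≢i | no k≢j = inj₂ (gp i j k i≢j (≢-sym k≢j) (≢-sym k≢i))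

  Δ-sign : i ≢ j → j ≢ k → i ≢ k → 0# < Δ i j k ⊎ 0# < Δ i k j
  Δ-sign {i} {j} {k} i≢j j≢k i≢k with x≢0⇒0<x⊎x<0 (gp i j k i≢j j≢k i≢k)
  ... | inj₁ 0<Δ = inj₁ 0<Δ
  ... | inj₂ Δ<0 = inj₂ (subst (0# <_) (sym (orient-swapʳ (p i) (p j) (p k))) (neg-negative Δ<0))

  Δ-antisym : 0# < Δ i j k → ¬ 0# < Δ i k j
  Δ-antisym {i} {j} {k} 0<Δijk 0<Δikj =
    0<x⇒¬x<0 0<Δikj (subst (_< 0#) (sym (orient-swapʳ (p i) (p j) (p k))) (neg-positive 0<Δijk))

  Δ-positive⇒≢₁₃ : 0# < Δ i j k → i ≢ k
  Δ-positive⇒≢₁₃ {i} {j} (_ , 0≢Δ) refl = 0≢Δ (sym (orient-xyx≡0 (p i) (p j)))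

  Δ-positive⇒≢₂₃ : 0# < Δ i j k → j ≢ k
  Δ-positive⇒≢₂₃ {i} {j} (_ , 0≢Δ) refl = 0≢Δ (sym (orient-xyy≡0 (p i) (p j)))

  LeftEdge : Fin n → Fin n → Set
  LeftEdge i j = i ≢ j × ∀ k → 0# ≤ Δ i j k

  leftEdge-positive : LeftEdge i j → k ≢ i → k ≢ j → 0# < Δ i j k
  leftEdge-positive {i} {j} {k} (i≢j , 0≤Δ) k≢i k≢j =
    0≤Δ k , λ 0≡Δ → gp i j k i≢j (≢-sym k≢j) (≢-sym k≢i) (sym 0≡Δ)

  leftEdge-functional : ∀ {j′} → LeftEdge i j → LeftEdge i j′ → j ≡ j′
  leftEdge-functional {i} {j} {j′} e e′ with j Fin.≟ j′
  ... | yes j≡j′ = j≡j′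
  ... | no j≢j′ = ⊥-elim (Δ-antisym (leftEdge-positive e (≢-sym (proj₁ e′)) (≢-sym j≢j′))
                                     (leftEdge-positive e′ (≢-sym (proj₁ e)) j≢j′))

  leftEdge-injective : ∀ {i′} → LeftEdge i j → LeftEdge i′ j → i ≡ i′
  leftEdge-injective {i} {j} {i′} e e′ with i Fin.≟ i′
  ... | yes i≡i′ = i≡i′
  ... | no i≢i′ = ⊥-elim (Δ-antisym
    (subst (0# <_) (orient-rotate (p i) (p j) (p i′)) (leftEdge-positive e (≢-sym i≢i′) (proj₁ e′)))
    (subst (0# <_) (orient-rotate (p i′) (p j) (p i)) (leftEdge-positive e′ i≢i′ (proj₁ e))))

  leftEdge-asym : LeftEdge i j → ¬ LeftEdge j i
  leftEdge-asym {i} {j} e e′ with fin-third 3≤n i j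
  ... | k , k≢i , k≢j = Δ-antisym (leftEdge-positive e k≢i k≢j)
    (subst (0# <_) (orient-rotate (p j) (p i) (p k)) (leftEdge-positive e′ k≢j k≢i))

  leftEdge⇒hullEdge : LeftEdge i j → HullEdge p i j
  leftEdge⇒hullEdge (i≢j , 0≤Δ) = i≢j , inj₁ 0≤Δ

  leftEdge⇒hullEdge′ : LeftEdge i j → HullEdge p j i
  leftEdge⇒hullEdge′ {i} {j} (i≢j , 0≤Δ) = ≢-sym i≢j , inj₂ λ k →
    subst (_≤ 0#) (sym (orient-swapˡ (p i) (p j) (p k))) (0≤x⇒-x≤0 (0≤Δ k))

  hullEdge? : ∀ i j → Dec (HullEdge p i j)
  hullEdge? i j with i Fin.≟ j
  ... | yes i≡j = no (λ e → proj₁ e i≡j)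
  ... | no i≢j with Fin.all? (λ k → 0≤? (Δ≡0⊎Δ≢0 i≢j k)) | Fin.all? (λ k → ≤0? (Δ≡0⊎Δ≢0 i≢j k))
  ...   | yes 0≤Δ | _ = yes (i≢j , inj₁ 0≤Δ)
  ...   | no _ | yes Δ≤0 = yes (i≢j , inj₂ Δ≤0)
  ...   | no ¬0≤Δ | no ¬Δ≤0 = no λ { (_ , inj₁ 0≤Δ) → ¬0≤Δ 0≤Δ ; (_ , inj₂ Δ≤0) → ¬Δ≤0 Δ≤0 }

  -- Gift wrapping. The exchange hypothesis says that h is affine and vanishes at p o; the point
  -- that comes first in angular order around p o then closes a left edge.
  leftEdge-from : ∀ o (h : Fin n → ℝ) → (∀ q → 0# ≤ h q) →
    (∀ a b c → Δ o a c * h b ≡ Δ o a b * h c + Δ o b c * h a) →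
    (∀ a b → a ≢ o → b ≢ o → a ≢ b → h a ≡ 0# → h b ≢ 0#) → ∃ (LeftEdge o)
  leftEdge-from o h 0≤h exchange generic = fromMinimum (minimum (allFin n))
    where
    _≺_ : Fin n → Fin n → Set
    c ≺ x = 0# < Δ o c x

    ≢o? : Decidable (_≢ o)
    ≢o? q = ¬? (q Fin.≟ o)

    ≺-total : ∀ {x y} → x ≢ o → y ≢ o → x ≢ y → x ≺ y ⊎ y ≺ x
    ≺-total x≢o y≢o x≢y = Δ-sign (≢-sym x≢o) x≢y (≢-sym y≢o)

    ≺-trans : ∀ {x y z} → x ≢ o → y ≢ o → z ≢ o → x ≢ y → y ≢ z → x ≢ z → x ≺ y → y ≺ z → x ≺ z
    ≺-trans {x} {y} {z} x≢o y≢o z≢o x≢y y≢z x≢z =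
      combination-positive (exchange x y z) (0≤h x) (0≤h y) (0≤h z) (generic x y x≢o y≢o x≢y)
        (gp o x z (≢-sym x≢o) x≢z (≢-sym z≢o))

    open ListMinimum Fin._≟_ (_≢ o) ≢o? _≺_ ≺-total ≺-trans

    fromMinimum : (∀ x → x ∈ allFin n → ¬ x ≢ o) ⊎ ∃ (Minimum (allFin n)) → ∃ (LeftEdge o)
    fromMinimum (inj₁ none) with fin-third 3≤n o o
    ... | q , q≢o , _ = ⊥-elim (none q (∈-allFin q) q≢o)
    fromMinimum (inj₂ (c , c≢o , least)) = c , ≢-sym c≢o , 0≤Δ
      where
      0≤Δ : ∀ k → 0# ≤ Δ o c k
      0≤Δ k with k Fin.≟ o | k Fin.≟ c
      ... | yes refl | _ = ≤-reflexive (sym (orient-xyx≡0 (p k) (p c)))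
      ... | no _ | yes refl = ≤-reflexive (sym (orient-xyy≡0 (p o) (p k)))
      ... | no k≢o | no k≢c = proj₁ (least k (∈-allFin k) k≢o k≢c)

  leftEdge-next : LeftEdge i j → ∃ (LeftEdge j)
  leftEdge-next {i} {j} (i≢j , 0≤Δ) = leftEdge-from j (Δ i j) 0≤Δ
    (λ a b c → orient-exchange-tail (p i) (p j) (p a) (p b) (p c)) generic
    where
    generic : ∀ a b → a ≢ j → b ≢ j → a ≢ b → Δ i j a ≡ 0# → Δ i j b ≢ 0#
    generic a b a≢j b≢j a≢b Δija≡0 with a Fin.≟ i
    ... | yes refl = gp a j b i≢j (≢-sym b≢j) a≢b
    ... | no a≢i = ⊥-elim (gp i j a i≢j (≢-sym a≢j) (≢-sym a≢i) Δija≡0)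

  lowest-point : ∃[ l ] ∀ q → proj₂ (p l) ≤ proj₂ (p q)
  lowest-point = fromMinimum (minimum (allFin n))
    where
    _≼_ : Fin n → Fin n → Set
    c ≼ x = proj₂ (p c) ≤ proj₂ (p x)

    ≼-total : ∀ {x y} → U x → U y → x ≢ y → x ≼ y ⊎ y ≼ x
    ≼-total _ _ _ = ≤-total _ _

    ≼-trans : ∀ {x y z} → U x → U y → U z → x ≢ y → y ≢ z → x ≢ z → x ≼ y → y ≼ z → x ≼ z
    ≼-trans _ _ _ _ _ _ = ≤-trans

    open ListMinimum Fin._≟_ U U? _≼_ ≼-total ≼-trans

    fromMinimum : (∀ x → x ∈ allFin n → ¬ U x) ⊎ ∃ (Minimum (allFin n)) → ∃[ l ] ∀ q → l ≼ q
    fromMinimum (inj₁ none) = ⊥-elim (none q (∈-allFin q) tt)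
      where
      q = Fin.fromℕ< (ℕ.<-≤-trans (s≤s ℕ.z≤n) 3≤n)
    fromMinimum (inj₂ (l , _ , least)) = l , lowest
      where
      lowest : ∀ q → l ≼ q
      lowest q with q Fin.≟ l
      ... | yes refl = ≤-refl _
      ... | no q≢l = least q (∈-allFin q) tt q≢l

  leftEdge-exists : ∃₂ LeftEdge
  leftEdge-exists with lowest-point
  ... | l , lowest = l , leftEdge-from l height (λ q → x≤y⇒0≤y-x (lowest q))
    (λ a b c → orient-exchange-ordinate (p l) (p a) (p b) (p c)) generic
    where
    height : Fin n → ℝ
    height q = proj₂ (p q) - proj₂ (p l)

    generic : ∀ a b → a ≢ l → b ≢ l → a ≢ b → height a ≡ 0# → height b ≢ 0#
    generic a b a≢l b≢l a≢b ha≡0 hb≡0 =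
      gp l a b (≢-sym a≢l) a≢b (≢-sym b≢l) (orient-horizontal (p l) (p a) (p b) ha≡0 hb≡0)

  record Arc : Set where
    constructor arc
    field
      {tail head} : Fin n
      leftEdge : LeftEdge tail head

  arcs : ℕ → Arc
  arcs zero = arc (proj₂ (proj₂ leftEdge-exists))
  arcs (suc k) = arc (proj₂ (leftEdge-next (Arc.leftEdge (arcs k))))

  -- Opaque: only hull-leftEdge is needed, and unfolding the walk stalls type checking.
  opaque
    hull : ℕ → Fin n
    hull k = Arc.tail (arcs k)

    hull-leftEdge : ∀ k → LeftEdge (hull k) (hull (suc k))
    hull-leftEdge k = Arc.leftEdge (arcs k)

  hull-skip : ∀ k → hull (suc (suc k)) ≢ hull k
  hull-skip k eq = leftEdge-asym (hull-leftEdge k) (subst (LeftEdge (hull (suc k))) eq (hull-leftEdge (suc k)))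

  hull-step : ∀ k l → hull k ≡ hull l → hull (suc k) ≡ hull (suc l)
  hull-step k l eq =
    leftEdge-functional (hull-leftEdge k) (subst (λ x → LeftEdge x (hull (suc l))) (sym eq) (hull-leftEdge l))

  hull-unstep : ∀ k l → hull (suc k) ≡ hull (suc l) → hull k ≡ hull l
  hull-unstep k l eq = leftEdge-injective (hull-leftEdge k) (subst (LeftEdge (hull l)) (sym eq) (hull-leftEdge l))

  hull-cancel : ∀ i k l → hull (i ℕ.+ k) ≡ hull (i ℕ.+ l) → hull k ≡ hull l
  hull-cancel zero k l eq = eq
  hull-cancel (suc i) k l eq = hull-cancel i k l (hull-unstep (i ℕ.+ k) (i ℕ.+ l) eq)

  opaque
    period : ∃[ m ] hull (suc m) ≡ hull 0
    period with Fin.pigeonhole (ℕ.n<1+n n) (λ (k : Fin (suc n)) → hull (toℕ k))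
    ... | i , j , i<j , hullᵢ≡hullⱼ with ℕ.m≤n⇒∃[o]m+o≡n i<j
    ...   | m , 1+i+m≡j = m , hull-cancel (toℕ i) (suc m) 0 (begin
      hull (toℕ i ℕ.+ suc m)    ≡⟨ cong hull (trans (ℕ.+-suc (toℕ i) m) 1+i+m≡j) ⟩
      hull (toℕ j)              ≡⟨ sym hullᵢ≡hullⱼ ⟩
      hull (toℕ i)              ≡⟨ cong hull (sym (ℕ.+-identityʳ (toℕ i))) ⟩
      hull (toℕ i ℕ.+ 0)        ∎)
      where open ≡-Reasoning

  T : ℕ
  T = suc (proj₁ period)

  hull-periodic : ∀ k → hull (k ℕ.+ T) ≡ hull k
  hull-periodic zero = proj₂ period
  hull-periodic (suc k) = hull-step (k ℕ.+ T) k (hull-periodic k)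

  hull-mod : ∀ k → ∃[ r ] r ℕ.< T × hull k ≡ hull r
  hull-mod zero = zero , s≤s ℕ.z≤n , refl
  hull-mod (suc k) with hull-mod k
  ... | r , r<T , hullₖ≡hullᵣ with ℕ.m≤n⇒m<n∨m≡n r<T
  ...   | inj₁ 1+r<T = suc r , 1+r<T , hull-step k r hullₖ≡hullᵣ
  ...   | inj₂ 1+r≡T = zero , s≤s ℕ.z≤n ,
          trans (hull-step k r hullₖ≡hullᵣ) (trans (cong hull 1+r≡T) (proj₂ period))

  OnHull : Fin n → Set
  OnHull z = ∃[ k ] hull k ≡ z

  onHull? : Decidable OnHull
  onHull? z with Fin.any? (λ (r : Fin T) → hull (toℕ r) Fin.≟ z)
  ... | yes (r , hullᵣ≡z) = yes (toℕ r , hullᵣ≡z)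
  ... | no ∄r = no λ { (k , hullₖ≡z) → reduce k hullₖ≡z (hull-mod k) }
    where
    reduce : ∀ k → hull k ≡ z → ∃[ r ] r ℕ.< T × hull k ≡ hull r → ⊥
    reduce k hullₖ≡z (r , r<T , hullₖ≡hullᵣ) =
      ∄r (Fin.fromℕ< r<T , trans (cong hull (Fin.toℕ-fromℕ< r<T)) (trans (sym hullₖ≡hullᵣ) hullₖ≡z))

  hull-sees : ∀ k {z} → hull k ≢ z → hull (suc k) ≢ z → 0# < Δ z (hull k) (hull (suc k))
  hull-sees k {z} hullₖ≢z hullₖ₊₁≢z =
    subst (0# <_) (sym (orient-rotate (p z) (p (hull k)) (p (hull (suc k)))))
      (leftEdge-positive (hull-leftEdge k) (≢-sym hullₖ≢z) (≢-sym hullₖ₊₁≢z))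

  -- Among the hull vertices strictly left of z → hull 0, the last one c in angular order around z
  -- has its hull successor strictly to the right.
  enclosing-triangle : ∀ z → (∀ k → hull k ≢ z) → ∃[ kx ] ∃[ ky ] ∃[ kw ]
    0# < Δ z (hull kx) (hull ky) × 0# < Δ z (hull ky) (hull kw) × 0# < Δ z (hull kw) (hull kx)
  enclosing-triangle z off = fromMinimum (minimum (allFin n))
    where
    x : Fin n
    x = hull 0

    Ahead : Fin n → Set
    Ahead y = OnHull y × 0# < Δ z x y

    ahead? : Decidable Ahead
    ahead? y = onHull? y ×-dec 0<? (Δ≡0⊎Δ≢0 (≢-sym (off 0)) y)

    _≺_ : Fin n → Fin n → Set
    c ≺ y = 0# < Δ z y c

    ≺-total : ∀ {c y} → Ahead c → Ahead y → c ≢ y → c ≺ y ⊎ y ≺ c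
    ≺-total (_ , 0<Δzxc) (_ , 0<Δzxy) c≢y =
      Δ-sign (Δ-positive⇒≢₁₃ 0<Δzxy) (≢-sym c≢y) (Δ-positive⇒≢₁₃ 0<Δzxc)

    ≺-trans : ∀ {a b c} → Ahead a → Ahead b → Ahead c → a ≢ b → b ≢ c → a ≢ c → a ≺ b → b ≺ c → a ≺ c
    ≺-trans {a} {b} {c} (_ , 0<Δzxa) (_ , 0<Δzxb) (_ , 0<Δzxc) _ _ a≢c a≺b b≺c =
      combination-positive (orient-exchange-head (p z) (p x) (p c) (p b) (p a))
        (proj₁ 0<Δzxc) (proj₁ 0<Δzxb) (proj₁ 0<Δzxa) (λ Δzxc≡0 → ⊥-elim (0<x⇒x≢0 0<Δzxc Δzxc≡0))
        (gp z c a (Δ-positive⇒≢₁₃ 0<Δzxc) (≢-sym a≢c) (Δ-positive⇒≢₁₃ 0<Δzxa)) b≺c a≺b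

    open ListMinimum Fin._≟_ Ahead ahead? _≺_ ≺-total ≺-trans

    fromMinimum : (∀ y → y ∈ allFin n → ¬ Ahead y) ⊎ ∃ (Minimum (allFin n)) → ∃[ kx ] ∃[ ky ] ∃[ kw ]
      0# < Δ z (hull kx) (hull ky) × 0# < Δ z (hull ky) (hull kw) × 0# < Δ z (hull kw) (hull kx)
    fromMinimum (inj₁ none) = ⊥-elim (none (hull 1) (∈-allFin _) ((1 , refl) , hull-sees 0 (off 0) (off 1)))
    fromMinimum (inj₂ (c , ((kc , refl) , 0<Δzxc) , last)) = 0 , kc , suc kc , 0<Δzxc , 0<Δzcs , 0<Δzsx
      where
      s = hull (suc kc)

      0<Δzcs : 0# < Δ z c s
      0<Δzcs = hull-sees kc (off kc) (off (suc kc))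

      0<Δzsx : 0# < Δ z s x
      0<Δzsx with s Fin.≟ x
      ... | yes s≡x = ⊥-elim (Δ-antisym 0<Δzxc (subst (λ t → 0# < Δ z c t) s≡x 0<Δzcs))
      ... | no s≢x with Δ-sign (≢-sym (off 0)) (≢-sym s≢x) (≢-sym (off (suc kc)))
      ...   | inj₂ 0<Δzsx = 0<Δzsx
      ...   | inj₁ 0<Δzxs = ⊥-elim (Δ-antisym 0<Δzcs
                (last s (∈-allFin s) ((suc kc , refl) , 0<Δzxs) (≢-sym (Δ-positive⇒≢₂₃ 0<Δzcs))))

module Rigidity (R : Reals) {n : ℕ} (3≤n : 3 ℕ.≤ n)
  (p : Fin n → Geometry.ℝ² R) (gp : Geometry.GeneralPosition R p)
  (a b : Fin n) (ya≢yb : proj₂ (p a) ≢ proj₂ (p b)) (f : Fin n → Fin n → Reals.ℝ R) where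
  open Reals R
  open RealsProperties R
  open Geometry R hiding (Bounded)
  open PlaneIdentities R
  open ConvexHull R 3≤n p gp
  open BoundedFunctions R (InX p a b f)

  private
    variable
      i j x y z w : Fin n

  Motion : Set
  Motion = Fin n → ℝ²

  strain : Fin n → Fin n → Motion → ℝ
  strain i j v = ⟨ p i -² p j , v i -² v j ⟩

  BoundedStrain : Fin n → Fin n → Set
  BoundedStrain i j = Bounded (strain i j)

  boundedStrain-sym : BoundedStrain i j → BoundedStrain j i
  boundedStrain-sym {i} {j} = bounded-cong (λ v _ → inner-swap (p i) (p j) (v i) (v j))

  boundedStrain-self : ∀ i → BoundedStrain i i
  boundedStrain-self i = bounded-cong (λ v _ → sym (inner-self (p i) (v i))) (bounded-const 0#)

  private
    ordered-lowerBound : toℕ i ℕ.< toℕ j → ∀ v → InX p a b f v → f i j ≤ strain i j v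
    ordered-lowerBound {i} {j} i<j v (_ , _ , constraint) with hullEdge? i j
    ... | yes e = ≤-reflexive (sym (proj₁ (constraint i j i<j) e))
    ... | no ¬e = proj₂ (constraint i j i<j) ¬e

    ordered-hullEdge : toℕ i ℕ.< toℕ j → HullEdge p i j → BoundedStrain i j
    ordered-hullEdge {i} {j} i<j e =
      bounded-cong (λ v (_ , _ , constraint) → sym (proj₁ (constraint i j i<j) e)) (bounded-const (f i j))

  strain-boundedBelow : i ≢ j → BoundedBelow (strain i j)
  strain-boundedBelow {i} {j} i≢j with Fin.<-cmp i j
  ... | tri< i<j _ _ = f i j , ordered-lowerBound i<j
  ... | tri≈ _ i≡j _ = ⊥-elim (i≢j i≡j)
  ... | tri> _ _ j<i =
    boundedBelow-cong (λ v _ → inner-swap (p j) (p i) (v j) (v i)) (f j i , ordered-lowerBound j<i)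

  leftEdge⇒boundedStrain : LeftEdge i j → BoundedStrain i j
  leftEdge⇒boundedStrain {i} {j} e with Fin.<-cmp i j
  ... | tri< i<j _ _ = ordered-hullEdge i<j (leftEdge⇒hullEdge e)
  ... | tri≈ _ i≡j _ = ⊥-elim (proj₁ e i≡j)
  ... | tri> _ _ j<i = boundedStrain-sym (ordered-hullEdge j<i (leftEdge⇒hullEdge′ e))

  module K4 (z x y w : Fin n) where
    l₀ l₁ l₂ l₃ : ℝ
    l₀ = - Δ x y w
    l₁ = Δ z y w
    l₂ = Δ z w x
    l₃ = Δ z x y

    others : Motion → ℝ
    others v = l₀ * l₂ * strain z y v + l₀ * l₃ * strain z w v
             + l₁ * l₂ * strain x y v + l₁ * l₃ * strain x w v + l₂ * l₃ * strain y w v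

    balance : (λ v → l₀ * l₁ * strain z x v) ≈ (λ v → - others v)
    balance v _ = x+y≡0⇒x≡-y (stress-K4 (p z) (p x) (p y) (p w) (v z) (v x) (v y) (v w))

  boundedStrain-K4 : z ≢ y → z ≢ w → x ≢ y → x ≢ w → y ≢ w →
    BoundedStrain z y → BoundedStrain z w → BoundedStrain x y → BoundedStrain x w → BoundedStrain y w →
    BoundedStrain z x
  boundedStrain-K4 {z} {y} {w} {x} z≢y z≢w x≢y x≢w y≢w bzy bzw bxy bxw byw =
    bounded-÷ (*-nonzero l₀≢0 (gp z y w z≢y y≢w z≢w)) balance (bounded-neg
      (bounded-+ (bounded-+ (bounded-+ (bounded-+ (bounded-*ˡ _ bzy) (bounded-*ˡ _ bzw))
        (bounded-*ˡ _ bxy)) (bounded-*ˡ _ bxw)) (bounded-*ˡ _ byw)))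
    where
    open K4 z x y w
    l₀≢0 : l₀ ≢ 0#
    l₀≢0 l₀≡0 = gp x y w x≢y y≢w x≢w (-x≡0⇒x≡0 l₀≡0)

  boundedStrain-extend : ∀ {q} → x ≢ y → BoundedStrain x y →
    BoundedStrain z x → BoundedStrain z y → BoundedStrain q x → BoundedStrain q y → BoundedStrain z q
  boundedStrain-extend {x} {y} {z} {q} x≢y bxy bzx bzy bqx bqy
    with z Fin.≟ x | z Fin.≟ y | q Fin.≟ x | q Fin.≟ y
  ... | yes refl | _ | _ | _ = boundedStrain-sym bqx
  ... | no _ | yes refl | _ | _ = boundedStrain-sym bqy
  ... | no _ | no _ | yes refl | _ = bzx
  ... | no _ | no _ | no _ | yes refl = bzy
  ... | no z≢x | no z≢y | no q≢x | no q≢y = boundedStrain-K4 z≢x z≢y q≢x q≢y x≢y bzx bzy bqx bqy bxy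

  -- With p z inside the triangle, l₀ < 0 < l₁, l₂, l₃: the stress turns the lower bounds on the
  -- spokes z y and z w into an upper bound on z x.
  boundedStrain-spoke : 0# < Δ z y w → 0# < Δ z w x → 0# < Δ z x y →
    BoundedStrain x y → BoundedStrain x w → BoundedStrain y w → BoundedStrain z x
  boundedStrain-spoke {z} {y} {w} {x} 0<l₁ 0<l₂ 0<l₃ bxy bxw byw =
    strain-boundedBelow (Δ-positive⇒≢₁₃ 0<l₂) ,
    boundedAbove-÷-negative (*-negative-positive l₀<0 0<l₁) balance (boundedBelow-neg
      (boundedAbove-+ (boundedAbove-+ (boundedAbove-+ (boundedAbove-+
        (boundedAbove-*ˡ-nonpos (proj₁ (*-negative-positive l₀<0 0<l₂)) (strain-boundedBelow (Δ-positive⇒≢₁₃ 0<l₃)))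
        (boundedAbove-*ˡ-nonpos (proj₁ (*-negative-positive l₀<0 0<l₃)) (strain-boundedBelow (Δ-positive⇒≢₁₃ 0<l₁))))
        (proj₂ (bounded-*ˡ _ bxy))) (proj₂ (bounded-*ˡ _ bxw))) (proj₂ (bounded-*ˡ _ byw))))
    where
    open K4 z x y w
    l₀<0 : l₀ < 0#
    l₀<0 = neg-positive (subst (0# <_) (sym (orient-split (p z) (p x) (p y) (p w)))
      (+-positive-nonneg (+-positive-nonneg 0<l₁ (proj₁ 0<l₂)) (proj₁ 0<l₃)))

  side : ℕ → ℝ²
  side k = p (hull (suc k)) -² p (hull k)

  ∥side∥²≢0 : ∀ k → ∥ side k ∥² ≢ 0#
  ∥side∥²≢0 k with fin-third 3≤n (hull k) (hull (suc k))
  ... | q , q≢hₖ , q≢hₖ₊₁ = det≢0⇒∥∥²≢0 (side k) (p q -² p (hull k))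
    (gp (hull k) (hull (suc k)) q (proj₁ (hull-leftEdge k)) (≢-sym q≢hₖ₊₁) (≢-sym q≢hₖ))

  -- The angular velocity of the k-th hull side.
  rate : ℕ → Motion → ℝ
  rate k v = inv ∥ side k ∥² (∥side∥²≢0 k) * det (side k) (v (hull (suc k)) -² v (hull k))

  rate-periodic : ∀ k v → rate (k ℕ.+ T) v ≡ rate k v
  rate-periodic k v = cong₂ _*_ (inv-cong (cong ∥_∥² side≡) _ _)
    (cong₂ det side≡ (cong₂ (λ s t → v s -² v t) (hull-periodic (suc k)) (hull-periodic k)))
    where
    side≡ : side (k ℕ.+ T) ≡ side k
    side≡ = cong₂ (λ s t → p s -² p t) (hull-periodic (suc k)) (hull-periodic k)

  turn : ℕ → ℝ
  turn k = Δ (hull k) (hull (suc k)) (hull (suc (suc k)))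

  0<turn : ∀ k → 0# < turn k
  0<turn k = leftEdge-positive (hull-leftEdge k) (hull-skip k) (≢-sym (proj₁ (hull-leftEdge (suc k))))

  corner : ℕ → Motion → ℝ
  corner k v = strain h₀ h₁ v + strain h₁ h₂ v
             + ⟨ p h₁ -² p h₀ , p h₂ -² p h₁ ⟩ * (inv ∥ side k ∥² (∥side∥²≢0 k) * strain h₀ h₁ v
                                                + inv ∥ side (suc k) ∥² (∥side∥²≢0 (suc k)) * strain h₁ h₂ v)
    where
    h₀ = hull k
    h₁ = hull (suc k)
    h₂ = hull (suc (suc k))

  boundedStrain-hullSide : ∀ k → BoundedStrain (hull k) (hull (suc k))
  boundedStrain-hullSide k = leftEdge⇒boundedStrain (hull-leftEdge k)

  corner-bounded : ∀ k → Bounded (corner k)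
  corner-bounded k = bounded-+ (bounded-+ (boundedStrain-hullSide k) (boundedStrain-hullSide (suc k)))
    (bounded-*ˡ _ (bounded-+ (bounded-*ˡ _ (boundedStrain-hullSide k))
                              (bounded-*ˡ _ (boundedStrain-hullSide (suc k)))))

  strain-hullDiagonal : ∀ k v →
    strain (hull k) (hull (suc (suc k))) v ≡ corner k v + turn k * (rate k v - rate (suc k) v)
  strain-hullDiagonal k v = strain-diagonal (p (hull k)) (p (hull (suc k))) (p (hull (suc (suc k))))
    (v (hull k)) (v (hull (suc k))) (v (hull (suc (suc k))))
    (*-inverseʳ _ (∥side∥²≢0 k)) (*-inverseʳ _ (∥side∥²≢0 (suc k)))

  rateDrop-boundedBelow : ∀ k → BoundedBelow (λ v → rate k v - rate (suc k) v)
  rateDrop-boundedBelow k = boundedBelow-÷-positive (0<turn k)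
    (λ v _ → sym (x≡y+z⇒x-y≡z (strain-hullDiagonal k v)))
    (boundedBelow-+ (strain-boundedBelow (≢-sym (hull-skip k))) (boundedBelow-neg (proj₂ (corner-bounded k))))

  rateDrift-boundedBelow : ∀ k m → BoundedBelow (λ v → rate k v - rate (m ℕ.+ k) v)
  rateDrift-boundedBelow k zero =
    boundedBelow-cong (λ v _ → sym (-‿inverseʳ (rate k v))) (proj₁ (bounded-const 0#))
  rateDrift-boundedBelow k (suc m) = boundedBelow-cong
    (λ v _ → solve 3 (λ r s t → (r :- s) :+ (s :- t) := r :- t) refl
                 (rate k v) (rate (m ℕ.+ k) v) (rate (suc m ℕ.+ k) v))
    (boundedBelow-+ (rateDrift-boundedBelow k m) (rateDrop-boundedBelow (m ℕ.+ k)))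

  -- Around the closed hull polygon the drops telescope to zero, so each drop is minus the sum of the others.
  rateDrop-boundedAbove : ∀ k → BoundedAbove (λ v → rate k v - rate (suc k) v)
  rateDrop-boundedAbove k = boundedAbove-cong opposite (boundedAbove-neg (rateDrift-boundedBelow (suc k) m))
    where
    m = proj₁ period
    wrap : ∀ v → rate (m ℕ.+ suc k) v ≡ rate k v
    wrap v = trans (cong (λ t → rate t v) (trans (ℕ.+-comm m (suc k)) (sym (ℕ.+-suc k m)))) (rate-periodic k v)
    opposite : (λ v → - (rate (suc k) v - rate (m ℕ.+ suc k) v)) ≈ (λ v → rate k v - rate (suc k) v)
    opposite v _ = trans (cong (λ t → - (rate (suc k) v - t)) (wrap v))
      (solve 2 (λ r s → :- (s :- r) := r :- s) refl (rate k v) (rate (suc k) v))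

  boundedStrain-hullDiagonal : ∀ k → BoundedStrain (hull k) (hull (suc (suc k)))
  boundedStrain-hullDiagonal k = strain-boundedBelow (≢-sym (hull-skip k)) ,
    boundedAbove-cong (λ v _ → sym (strain-hullDiagonal k v))
      (boundedAbove-+ (proj₂ (corner-bounded k)) (boundedAbove-*ˡ (proj₁ (0<turn k)) (rateDrop-boundedAbove k)))

  boundedStrain-hullGap : ∀ g k → BoundedStrain (hull k) (hull (g ℕ.+ k))
  boundedStrain-hullGap 0 k = boundedStrain-self (hull k)
  boundedStrain-hullGap 1 k = boundedStrain-hullSide k
  boundedStrain-hullGap 2 k = boundedStrain-hullDiagonal k
  boundedStrain-hullGap (suc (suc (suc g))) k = boundedStrain-sym (boundedStrain-extend
    (proj₁ (hull-leftEdge (suc r))) (boundedStrain-hullSide (suc r))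
    (boundedStrain-sym (boundedStrain-hullDiagonal (suc r))) (boundedStrain-sym (boundedStrain-hullSide (suc (suc r))))
    (boundedStrain-hullGap (suc g) k) (boundedStrain-hullGap (suc (suc g)) k))
    where
    r = g ℕ.+ k

  boundedStrain-hull : ∀ k l → BoundedStrain (hull k) (hull l)
  boundedStrain-hull k l with ℕ.≤-total k l
  ... | inj₁ k≤l =
    subst (λ t → BoundedStrain (hull k) (hull t)) (ℕ.m∸n+n≡m k≤l) (boundedStrain-hullGap (l ℕ.∸ k) k)
  ... | inj₂ l≤k = boundedStrain-sym
    (subst (λ t → BoundedStrain (hull l) (hull t)) (ℕ.m∸n+n≡m l≤k) (boundedStrain-hullGap (k ℕ.∸ l) l))

  Anchored : Fin n → Set
  Anchored z = ∃[ kx ] ∃[ ky ] hull kx ≢ hull ky × BoundedStrain z (hull kx) × BoundedStrain z (hull ky)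

  anchored : ∀ z → Anchored z
  anchored z with onHull? z
  ... | yes (k , refl) = k , suc k , proj₁ (hull-leftEdge k) , boundedStrain-hull k k , boundedStrain-hull k (suc k)
  ... | no off with enclosing-triangle z (λ k hullₖ≡z → off (k , hullₖ≡z))
  ...   | kx , ky , kw , 0<Δzxy , 0<Δzyw , 0<Δzwx =
    kx , ky , Δ-positive⇒≢₂₃ 0<Δzxy ,
    boundedStrain-spoke 0<Δzyw 0<Δzwx 0<Δzxy
      (boundedStrain-hull kx ky) (boundedStrain-hull kx kw) (boundedStrain-hull ky kw) ,
    boundedStrain-spoke 0<Δzwx 0<Δzxy 0<Δzyw
      (boundedStrain-hull ky kw) (boundedStrain-hull ky kx) (boundedStrain-hull kw kx)

  boundedStrain-toHull : ∀ z k → BoundedStrain z (hull k)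
  boundedStrain-toHull z k with anchored z
  ... | kx , ky , x≢y , bzx , bzy = boundedStrain-extend x≢y (boundedStrain-hull kx ky) bzx bzy
    (boundedStrain-hull k kx) (boundedStrain-hull k ky)

  boundedStrain : ∀ i j → BoundedStrain i j
  boundedStrain i j with anchored i
  ... | kx , ky , x≢y , bix , biy = boundedStrain-extend x≢y (boundedStrain-hull kx ky) bix biy
    (boundedStrain-toHull j kx) (boundedStrain-toHull j ky)

  BoundedVelocity : Fin n → Set
  BoundedVelocity i = Bounded (λ v → proj₁ (v i)) × Bounded (λ v → proj₂ (v i))

  boundedVelocity-a : BoundedVelocity a
  boundedVelocity-a = bounded-cong (λ v (va≡0 , _) → sym (cong proj₁ va≡0)) (bounded-const 0#)
                    , bounded-cong (λ v (va≡0 , _) → sym (cong proj₂ va≡0)) (bounded-const 0#)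

  bounded-inner-velocity : BoundedVelocity j → ∀ i → Bounded (λ v → ⟨ p j -² p i , v i ⟩)
  bounded-inner-velocity {j} (bj₁ , bj₂) i =
    bounded-cong eq (bounded-+ (bounded-inner (p j -² p i) bj₁ bj₂) (bounded-neg (boundedStrain j i)))
    where
    eq : (λ v → ⟨ p j -² p i , v j ⟩ - strain j i v) ≈ (λ v → ⟨ p j -² p i , v i ⟩)
    eq v _ = trans (cong (_-_ ⟨ p j -² p i , v j ⟩) (inner-distribˡ-sub (p j -² p i) (v j) (v i)))
      (solve 2 (λ s t → s :- (s :- t) := t) refl ⟨ p j -² p i , v j ⟩ ⟨ p j -² p i , v i ⟩)

  boundedVelocity-b : BoundedVelocity b
  boundedVelocity-b = vb₁ , bounded-÷ ya-yb≢0 (λ v _ → sym (x≡y+z⇒x-y≡z refl))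
    (bounded-+ (bounded-inner-velocity boundedVelocity-a b) (bounded-neg (bounded-*ˡ _ vb₁)))
    where
    vb₁ : Bounded (λ v → proj₁ (v b))
    vb₁ = bounded-cong (λ v (_ , vb₁≡0 , _) → sym vb₁≡0) (bounded-const 0#)
    ya-yb≢0 : proj₂ (p a) - proj₂ (p b) ≢ 0#
    ya-yb≢0 ya-yb≡0 = ya≢yb (x-y≡0⇒x≡y ya-yb≡0)

  boundedVelocity : ∀ i → BoundedVelocity i
  boundedVelocity i with i Fin.≟ a | i Fin.≟ b
  ... | yes refl | _ = boundedVelocity-a
  ... | no _ | yes refl = boundedVelocity-b
  ... | no i≢a | no i≢b = bounded-cramer (p a -² p i) (p b -² p i) (gp i a b i≢a a≢b i≢b)
    (bounded-inner-velocity boundedVelocity-a i) (bounded-inner-velocity boundedVelocity-b i)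
    where
    a≢b : a ≢ b
    a≢b a≡b = ya≢yb (cong (λ t → proj₂ (p t)) a≡b)

open import Data.Nat using (_≤_)

lemma3p4 : (R : Reals) → (n : ℕ) → 3 ≤ n →
    let open Reals R in let open Geometry R in
    (p : Fin n → ℝ²) → GeneralPosition p →
    (a b : Fin n) → proj₂ (p a) ≢ proj₂ (p b) →
    (f : Fin n → Fin n → ℝ) → Bounded (InX p a b f)
lemma3p4 R n 3≤n p gp a b ya≢yb f = boundedBy-finite² (λ i v → v i) boundedVelocity
  where
  open BoundedFunctions R (Geometry.InX R p a b f)
  open Rigidity R 3≤n p gp a b ya≢yb f
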